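{- An undirected, triangle-free graph (loops allowed) generates a fusion ring if and only if it is isomorphic to one of: (1) a single vertex with a self-loop; (2) a single edge with a self-loop on exactly one of its endpoints; (3) a single edge with self-loops on both endpoints, together with one isolated loopless vertex; (4) a collection of $2^k-1$ isolated loopless vertices, for some integer $k\ge0$.
   Context: A fusion ring of rank $r$ (commutative) is a commutative unital ring, free as a $\mathbb{Z}$-module on a basis $X_0=1,X_1,\dots,X_{r-1}$, with $X_iX_j=\sum_k N_{ij}^kX_k$, $N_{ij}^k\in\mathbb{Z}_{\ge0}$, and an involution $i\mapsto i^*$ with $N_{ij}^0=\delta_{i,j^*}$ and $N_{ij}^k=N_{jk^*}^{i^*}=N_{j^*i^*}^{k^*}$. It is self-dual if $i^*=i$ for all $i$, multiplicity-free if all $N_{ij}^k\in\{0,1\}$. For such a ring the associated digraph $D$ on $\{1,\dots,r-1\}$ has a loop at $i$ iff $N_{ii}^i=1$ and, for $i\ne j$, an arc $(i,j)$ iff $N_{ii}^j=1$; the associated $3$-uniform hypergraph $H$ has hyperedge $\{i,j,k\}$ (distinct) iff $N_{ij}^k=1$. A digraph generates a fusion ring if it is the associated digraph of some self-dual multiplicity-free fusion ring. An undirected graph (possibly with loops) is identified with the digraph having arcs $(i,j),(j,i)$ for each edge $\{i,j\}$, $i\ne j$. Triangle-free: no three distinct pairwise adjacent vertices. -}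

module Defs where

open import Data.Nat using (ℕ; zero; suc; _+_; _*_; _≤_)
open import Data.Bool using (Bool; true; false; T; if_then_else_)
open import Data.Fin using (Fin; zero; suc; _≟_)
open import Data.List using (List; map; allFin)
open import Data.Nat.ListAction using (sum)
open import Data.Product using (Σ; _×_)
open import Data.Empty using (⊥)
open import Relation.Nullary using (¬_)
open import Relation.Nullary.Decidable using (⌊_⌋)
open import Relation.Binary.PropositionalEquality using (_≡_)
open import Function.Bundles using (_↔_; _⇔_; Inverse)

δ : ∀ {r} → Fin r → Fin r → ℕ
δ i j = if ⌊ i ≟ j ⌋ then 1 else 0

ΣFin : (r : ℕ) → (Fin r → ℕ) → ℕ
ΣFin r f = sum (map f (allFin r))

-- A self-dual, multiplicity-free (commutative) fusion ring of rank r,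
-- given by its structure constants N i j k = N_{ij}^k w.r.t. the basis
-- X_0 = 1, X_1, ..., X_{r-1} (index zero is the unit X_0).
-- The ring is the free ℤ-module on the basis with bilinearly extended
-- product X_i X_j = Σ_k N_{ij}^k X_k; commutative unital ring axioms for it
-- are exactly: unit, commutativity and associativity of the constants.
-- Rank r = suc n (rank ≥ 1 since X_0 = 1 is a basis element).
record SDMFFusionRing (r₁ : ℕ) : Set where
  r : ℕ
  r = suc r₁
  field
    N            : Fin r → Fin r → Fin r → ℕ
    multFree     : ∀ i j k → N i j k ≤ 1
    unit         : ∀ j k → N zero j k ≡ δ j k
    comm         : ∀ i j k → N i j k ≡ N j i k
    assoc        : ∀ i j k l →
                   ΣFin r (λ m → N i j m * N m k l) ≡ ΣFin r (λ m → N j k m * N i m l)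
    -- duality axioms with the trivial involution i* = i
    dual₀        : ∀ i j → N i j zero ≡ δ i j
    dualRot      : ∀ i j k → N i j k ≡ N j k i
    dualRev      : ∀ i j k → N i j k ≡ N j i k

open SDMFFusionRing public

-- Arcs/loops of the associated digraph on {1,...,r-1}; vertex i : Fin n
-- stands for basis index suc i (rank r = suc n).  Loop at i iff N_{ii}^i = 1,
-- arc (i,j) (i ≠ j) iff N_{ii}^j = 1; both are captured uniformly by:
Arc : ∀ {n} → SDMFFusionRing n → Fin n → Fin n → Set
Arc F i j = N F (suc i) (suc i) (suc j) ≡ 1

record Graph (n : ℕ) : Set where
  field
    adj    : Fin n → Fin n → Bool
    adjSym : ∀ i j → adj i j ≡ adj j i

open Graph public

TriangleFree : ∀ {n} → Graph n → Set
TriangleFree {n} G = ∀ (i j k : Fin n) → ¬ i ≡ j → ¬ j ≡ k → ¬ i ≡ k →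
  T (adj G i j) → T (adj G j k) → T (adj G i k) → ⊥

-- G generates a fusion ring: the digraph of G (arcs (i,j),(j,i) per edge,
-- loops kept) equals the associated digraph of some self-dual
-- multiplicity-free fusion ring of rank n + 1 (record index n).
Generates : ∀ {n} → Graph n → Set
Generates {n} G = Σ (SDMFFusionRing n) λ F → ∀ i j → (Arc F i j ⇔ T (adj G i j))

_≅_ : ∀ {n m} → Graph n → Graph m → Set
_≅_ {n} {m} G H = Σ (Fin n ↔ Fin m) λ f →
  ∀ i j → adj G i j ≡ adj H (Inverse.to f i) (Inverse.to f j)

loopVertex : Graph 1
loopVertex = record { adj = λ _ _ → true ; adjSym = λ _ _ → _≡_.refl }

edgeOneLoopAdj : Fin 2 → Fin 2 → Bool
edgeOneLoopAdj (suc zero) (suc zero) = false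
edgeOneLoopAdj _ _ = true

edgeOneLoop : Graph 2
edgeOneLoop = record { adj = edgeOneLoopAdj ; adjSym = s }
  where
  s : ∀ i j → edgeOneLoopAdj i j ≡ edgeOneLoopAdj j i
  s zero zero = _≡_.refl
  s zero (suc zero) = _≡_.refl
  s (suc zero) zero = _≡_.refl
  s (suc zero) (suc zero) = _≡_.refl

edgeTwoLoopsAdj : Fin 3 → Fin 3 → Bool
edgeTwoLoopsAdj zero zero = true
edgeTwoLoopsAdj zero (suc zero) = true
edgeTwoLoopsAdj (suc zero) zero = true
edgeTwoLoopsAdj (suc zero) (suc zero) = true
edgeTwoLoopsAdj _ _ = false

edgeTwoLoopsPlusPoint : Graph 3
edgeTwoLoopsPlusPoint = record { adj = edgeTwoLoopsAdj ; adjSym = s }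
  where
  s : ∀ i j → edgeTwoLoopsAdj i j ≡ edgeTwoLoopsAdj j i
  s zero zero = _≡_.refl
  s zero (suc zero) = _≡_.refl
  s zero (suc (suc zero)) = _≡_.refl
  s (suc zero) zero = _≡_.refl
  s (suc zero) (suc zero) = _≡_.refl
  s (suc zero) (suc (suc zero)) = _≡_.refl
  s (suc (suc zero)) zero = _≡_.refl
  s (suc (suc zero)) (suc zero) = _≡_.refl
  s (suc (suc zero)) (suc (suc zero)) = _≡_.refl

emptyGraph : (m : ℕ) → Graph m
emptyGraph m = record { adj = λ _ _ → false ; adjSym = λ _ _ → _≡_.refl }

-- Write |X_x X_y| for the number of constituents of X_x X_y. Associativity gives
-- |X_x X_y| = Σ_m N_xx^m N_yy^m, the number of common neighbours of x and y in the
-- digraph (counting 0 and loops), and Σ_m N_xy^m |X_m X_z| = Σ_m N_yz^m |X_x X_m|.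
-- In a triangle-free graph the first identity evaluates |X_x X_y| almost exactly,
-- and comparing the two sides of the second one for suitable x, y, z confines the
-- neighbourhoods of looped vertices.
-- Without loops there are no edges at all, so every X_x squares to 1, the basis is
-- an elementary abelian 2-group and its order is a power of 2. With a loop at a:
-- if a has no neighbour the graph is a single looped vertex; a loopless neighbour b
-- gives the looped edge; a looped neighbour b forces a third constituent k of X_a X_b,
-- which turns out to be an isolated loopless vertex, and nothing else exists.
-- Conversely the four graphs are realised by explicit rings, checked by computation,
-- and by the group rings of (ℤ/2)^k; generation is invariant under isomorphism.

module Submission where

open import Defs
open import Data.Nat using (ℕ; zero; suc; _+_; _*_; _≤_; _<_; z≤n; s≤s; _≤?_; _^_; _∸_)
import Data.Nat.Properties as ℕ
open import Data.Nat.Properties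
  using (+-*-semiring; ≤-refl; ≤-trans; ≤-reflexive; ≤-antisym; <-irrefl; 0≢1+n; 1+n≢n; n≤0⇒n≡0; n≤1⇒n≡0∨n≡1
        ; +-mono-≤; +-monoʳ-≤; +-monoˡ-≤; +-cancelˡ-≤; +-identityʳ; +-assoc; +-comm; m≤m+n; m≤n+m; m^n>0
        ; *-monoʳ-≤; *-identityˡ; *-identityʳ; *-zeroʳ; *-comm; *-distribˡ-+; module ≤-Reasoning)
open import Data.Nat.Tactic.RingSolver using (solve-∀)
open import Data.Nat.ListAction using () renaming (sum to sumList)
open import Data.Fin using (Fin; zero; suc; _≟_)
open import Data.Fin.Properties using (all?; any?; ¬∀⟶∃¬; suc-injective; *↔×; 2↔Bool)
open import Data.Fin.Permutation using (Permutation; permutation; lift₀; _⟨$⟩ʳ_; _⟨$⟩ˡ_; inverseˡ)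
open import Data.List using (List; []; _∷_; length; tabulate)
import Data.List as List
import Data.List.Properties as List
open import Data.List.Relation.Unary.All as All using (All; []; _∷_)
open import Data.List.Relation.Unary.Unique.Propositional using (Unique; []; _∷_)
open import Data.List.Relation.Binary.Pointwise using (Pointwise; []; _∷_)
open import Data.Vec using (Vec; []; _∷_; lookup; zipWith; replicate)
open import Data.Vec.Properties using (zipWith-assoc; zipWith-comm; zipWith-identityˡ)
import Data.Product
open Data.Product using (∃; ∃-syntax; _×_; _,_; proj₁; proj₂; uncurry)
open import Data.Product.Function.NonDependent.Propositional using (_×-↔_)
open import Data.Sum using (_⊎_; inj₁; inj₂)
open import Data.Bool using (Bool; true; false; T; _∨_; _xor_; if_then_else_)
open import Data.Bool.Properties using (T?; T-∨; T-≡; xor-assoc; xor-comm; xor-same)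
open import Data.Unit using (tt)
open import Data.Empty using (⊥; ⊥-elim)
open import Relation.Nullary using (¬_; ¬?; Dec; yes; no; does)
open import Relation.Nullary.Decidable using (True; toWitness; ⌊_⌋; _×-dec_)
open import Relation.Binary.PropositionalEquality
open import Function using (_∘_; id; _↔_; _⇔_; mk⇔; mk↔ₛ′; Inverse; Equivalence)
open import Function.Properties.Inverse using (↔-refl; ↔-trans)
open import Algebra.Properties.Semiring.Sum +-*-semiring
  using (sum; sum-cong-≗; sum-replicate-zero; ∑-distrib-+; ∑-comm; *-distribˡ-sum; ∑-permute)

private
  variable
    n m : ℕ

one-* : ∀ {u} v → u ≡ 1 → u * v ≡ v
one-* v u≡1 = trans (cong (_* v) u≡1) (*-identityˡ v)

zero-* : ∀ {u} v → u ≡ 0 → u * v ≡ 0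
zero-* v u≡0 = cong (_* v) u≡0

*-zero : ∀ u {v} → v ≡ 0 → u * v ≡ 0
*-zero u v≡0 = trans (cong (u *_) v≡0) (*-zeroʳ u)

one≤ : ∀ {u} → u ≡ 1 → 1 ≤ u
one≤ = ≤-reflexive ∘ sym

≤-*-pos : ∀ u {v} → 1 ≤ v → u ≤ u * v
≤-*-pos u 1≤v = subst (_≤ u * _) (*-identityʳ u) (*-monoʳ-≤ u 1≤v)

indicator : Bool → ℕ
indicator true  = 1
indicator false = 0

indicator≤1 : ∀ b → indicator b ≤ 1
indicator≤1 true  = s≤s z≤n
indicator≤1 false = z≤n

indicator≡1 : ∀ {b} → indicator b ≡ 1 → b ≡ true
indicator≡1 {true} _ = refl

indicator≡0 : ∀ {b} → indicator b ≡ 0 → b ≡ false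
indicator≡0 {false} _ = refl

ΣFin≡sum : ∀ n (f : Fin n → ℕ) → ΣFin n f ≡ sum f
ΣFin≡sum n f = trans (cong sumList (List.map-tabulate id f)) (list-sum n f)
  where
  list-sum : ∀ n (f : Fin n → ℕ) → sumList (tabulate f) ≡ sum f
  list-sum zero    f = refl
  list-sum (suc n) f = cong (f zero +_) (list-sum n (f ∘ suc))

sum-ones : ∀ n → sum {n} (λ _ → 1) ≡ n
sum-ones zero    = refl
sum-ones (suc n) = cong suc (sum-ones n)

sum-mono-≤ : {f g : Fin n → ℕ} → (∀ x → f x ≤ g x) → sum f ≤ sum g
sum-mono-≤ {zero}  f≤g = z≤n
sum-mono-≤ {suc n} f≤g = +-mono-≤ (f≤g zero) (sum-mono-≤ (f≤g ∘ suc))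

sum-nonzero : (f : Fin n → ℕ) → ¬ sum f ≡ 0 → ∃ λ x → ¬ f x ≡ 0
sum-nonzero {zero}  f ∑f≢0 = ⊥-elim (∑f≢0 refl)
sum-nonzero {suc n} f ∑f≢0 with f zero ℕ.≟ 0
... | no f0≢0 = zero , f0≢0
... | yes f0≡0 with sum-nonzero (f ∘ suc) (λ ∑≡0 → ∑f≢0 (cong₂ _+_ f0≡0 ∑≡0))
...   | x , fx≢0 = suc x , fx≢0

sumOver : List (Fin n) → (Fin n → ℕ) → ℕ
sumOver xs f = sumList (List.map f xs)

Outside : Fin n → List (Fin n) → Set
Outside m xs = All (λ x → ¬ m ≡ x) xs

erase : Fin n → (Fin n → ℕ) → Fin n → ℕ
erase x f m = if does (m ≟ x) then 0 else f m

eraseAll : List (Fin n) → (Fin n → ℕ) → Fin n → ℕ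
eraseAll []       f = f
eraseAll (x ∷ xs) f = erase x (eraseAll xs f)

erase-≢ : (f : Fin n → ℕ) {x m : Fin n} → ¬ m ≡ x → erase x f m ≡ f m
erase-≢ f {x} {m} m≢x with m ≟ x
... | yes m≡x = ⊥-elim (m≢x m≡x)
... | no _    = refl

sum-erase : (f : Fin n → ℕ) (x : Fin n) → sum f ≡ f x + sum (erase x f)
sum-erase {suc n} f zero    = refl
sum-erase {suc n} f (suc x) = begin
  f zero + sum (f ∘ suc)                          ≡⟨ cong (f zero +_) (sum-erase (f ∘ suc) x) ⟩
  f zero + (f (suc x) + sum (erase x (f ∘ suc)))  ≡⟨ +-comm-middle (f zero) (f (suc x)) _ ⟩
  f (suc x) + (f zero + sum (erase x (f ∘ suc)))  ≡⟨ cong (λ s → f (suc x) + (f zero + s)) (sum-cong-≗ erase-suc) ⟩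
  f (suc x) + sum (erase (suc x) f)               ∎
  where
  open ≡-Reasoning
  +-comm-middle : ∀ a b c → a + (b + c) ≡ b + (a + c)
  +-comm-middle = solve-∀
  erase-suc : ∀ m → erase x (f ∘ suc) m ≡ erase (suc x) f (suc m)
  erase-suc m with m ≟ x
  ... | yes _ = refl
  ... | no _  = refl

eraseAll-outside : (f : Fin n → ℕ) (xs : List (Fin n)) {m : Fin n} → Outside m xs → eraseAll xs f m ≡ f m
eraseAll-outside f []       []            = refl
eraseAll-outside f (x ∷ xs) (m≢x ∷ m∉xs) = trans (erase-≢ (eraseAll xs f) m≢x) (eraseAll-outside f xs m∉xs)

eraseAll-inside : (f : Fin n → ℕ) (xs : List (Fin n)) {m : Fin n} → ¬ Outside m xs → eraseAll xs f m ≡ 0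
eraseAll-inside f []       ¬m∉xs = ⊥-elim (¬m∉xs [])
eraseAll-inside f (x ∷ xs) {m} ¬m∉xs with m ≟ x
... | yes _   = refl
... | no m≢x = eraseAll-inside f xs (¬m∉xs ∘ (m≢x ∷_))

outside? : (m : Fin n) (xs : List (Fin n)) → Dec (Outside m xs)
outside? m = All.all? (λ x → ¬? (m ≟ x))

eraseAll-mono-≤ : {f g : Fin n → ℕ} (xs : List (Fin n)) → (∀ m → Outside m xs → f m ≤ g m) →
                  ∀ m → eraseAll xs f m ≤ eraseAll xs g m
eraseAll-mono-≤ {f = f} {g} xs f≤g m with outside? m xs
... | yes m∉xs = subst₂ _≤_ (sym (eraseAll-outside f xs m∉xs)) (sym (eraseAll-outside g xs m∉xs)) (f≤g m m∉xs)
... | no ¬m∉xs = subst (_≤ eraseAll xs g m) (sym (eraseAll-inside f xs ¬m∉xs)) z≤n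

sum-eraseAll : (f : Fin n → ℕ) {xs : List (Fin n)} → Unique xs → sum f ≡ sumOver xs f + sum (eraseAll xs f)
sum-eraseAll f []                          = refl
sum-eraseAll f {x ∷ xs} (x∉xs ∷ xs-unique) = begin
  sum f                                                         ≡⟨ sum-eraseAll f xs-unique ⟩
  sumOver xs f + sum (eraseAll xs f)                            ≡⟨ cong (sumOver xs f +_) (sum-erase (eraseAll xs f) x) ⟩
  sumOver xs f + (eraseAll xs f x + sum (eraseAll (x ∷ xs) f))  ≡⟨ cong (λ v → sumOver xs f + (v + sum (eraseAll (x ∷ xs) f)))
                                                                      (eraseAll-outside f xs x∉xs) ⟩
  sumOver xs f + (f x + sum (eraseAll (x ∷ xs) f))              ≡⟨ +-comm-middle (sumOver xs f) (f x) _ ⟩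
  f x + sumOver xs f + sum (eraseAll (x ∷ xs) f)                ∎
  where
  open ≡-Reasoning
  +-comm-middle : ∀ a b c → a + (b + c) ≡ b + a + c
  +-comm-middle = solve-∀

sum-supported : {n : ℕ} (f : Fin n → ℕ) {xs : List (Fin n)} → Unique xs →
                (∀ m → Outside m xs → f m ≡ 0) → sum f ≡ sumOver xs f
sum-supported {n} f {xs} xs-unique f≡0 = begin
  sum f                               ≡⟨ sum-eraseAll f xs-unique ⟩
  sumOver xs f + sum (eraseAll xs f)  ≡⟨ cong (sumOver xs f +_) (trans (sum-cong-≗ erased≡0) (sum-replicate-zero n)) ⟩
  sumOver xs f + 0                    ≡⟨ +-identityʳ _ ⟩
  sumOver xs f                        ∎
  where
  open ≡-Reasoning
  erased≡0 : ∀ m → eraseAll xs f m ≡ 0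
  erased≡0 m with outside? m xs
  ... | yes m∉xs = trans (eraseAll-outside f xs m∉xs) (f≡0 m m∉xs)
  ... | no ¬m∉xs = eraseAll-inside f xs ¬m∉xs

sumOver≤sum : (f : Fin n → ℕ) {xs : List (Fin n)} → Unique xs → sumOver xs f ≤ sum f
sumOver≤sum f {xs} xs-unique = subst (sumOver xs f ≤_) (sym (sum-eraseAll f xs-unique)) (m≤m+n _ _)

sumOver-ones : (f : Fin n → ℕ) {xs : List (Fin n)} → All (λ x → f x ≡ 1) xs → sumOver xs f ≡ length xs
sumOver-ones f []           = refl
sumOver-ones f (fx≡1 ∷ f≡1) = cong₂ _+_ fx≡1 (sumOver-ones f f≡1)

sum-indicator : (f : Fin n → ℕ) {xs : List (Fin n)} → Unique xs → All (λ x → f x ≡ 1) xs →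
                (∀ m → Outside m xs → f m ≡ 0) → sum f ≡ length xs
sum-indicator f xs-unique f≡1 f≡0 = trans (sum-supported f xs-unique f≡0) (sumOver-ones f f≡1)

sumOver-values : (f : Fin n → ℕ) {xs : List (Fin n)} {vs : List ℕ} →
                 Pointwise (λ x v → f x ≡ v) xs vs → sumOver xs f ≡ sumList vs
sumOver-values f []              = refl
sumOver-values f (fx≡v ∷ f≡vs) = cong₂ _+_ fx≡v (sumOver-values f f≡vs)

sumOver-bounds : (f : Fin n → ℕ) {xs : List (Fin n)} {vs : List ℕ} →
                 Pointwise (λ x v → v ≤ f x) xs vs → sumList vs ≤ sumOver xs f
sumOver-bounds f []              = z≤n
sumOver-bounds f (v≤fx ∷ vs≤f) = +-mono-≤ v≤fx (sumOver-bounds f vs≤f)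

length≤sum : (f : Fin n → ℕ) {xs : List (Fin n)} → Unique xs → All (λ x → 1 ≤ f x) xs → length xs ≤ sum f
length≤sum f xs-unique 1≤f = ≤-trans (length≤sumOver 1≤f) (sumOver≤sum f xs-unique)
  where
  length≤sumOver : ∀ {xs} → All (λ x → 1 ≤ f x) xs → length xs ≤ sumOver xs f
  length≤sumOver []           = z≤n
  length≤sumOver (1≤fx ∷ 1≤f) = +-mono-≤ 1≤fx (length≤sumOver 1≤f)

sum-saturated : (f : Fin n → ℕ) {xs : List (Fin n)} → Unique xs → All (λ x → f x ≡ 1) xs →
                sum f ≡ length xs → ∀ m → Outside m xs → f m ≡ 0
sum-saturated f {xs} xs-unique f≡1 ∑f≡len m m∉xs = n≤0⇒n≡0 (+-cancelˡ-≤ (length xs) _ _ (begin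
  length xs + f m                              ≡⟨ cong (_+ f m) (sym (sumOver-ones f f≡1)) ⟩
  sumOver xs f + f m                           ≡⟨ +-comm _ (f m) ⟩
  sumOver (m ∷ xs) f                           ≤⟨ sumOver≤sum f (m∉xs ∷ xs-unique) ⟩
  sum f                                        ≡⟨ ∑f≡len ⟩
  length xs                                    ≡⟨ +-identityʳ _ ⟨
  length xs + 0                                ∎))
  where
  open ≤-Reasoning

sum-excess : (f g : Fin n → ℕ) (e : ℕ) {xs : List (Fin n)} → Unique xs → sum g ≡ sum f + e →
             (∀ m → Outside m xs → f m ≤ g m) → sumOver xs g ≤ e + sumOver xs f
sum-excess f g e {xs} xs-unique ∑g≡∑f+e f≤g = +-cancelˡ-≤ (sum (eraseAll xs f)) _ _ (begin
  sum (eraseAll xs f) + sumOver xs g  ≤⟨ +-monoˡ-≤ _ (sum-mono-≤ (eraseAll-mono-≤ xs f≤g)) ⟩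
  sum (eraseAll xs g) + sumOver xs g  ≡⟨ +-comm _ (sumOver xs g) ⟩
  sumOver xs g + sum (eraseAll xs g)  ≡⟨ sum-eraseAll g xs-unique ⟨
  sum g                               ≡⟨ ∑g≡∑f+e ⟩
  sum f + e                           ≡⟨ cong (_+ e) (sum-eraseAll f xs-unique) ⟩
  sumOver xs f + sum (eraseAll xs f) + e  ≡⟨ rearrange (sumOver xs f) _ e ⟩
  sum (eraseAll xs f) + (e + sumOver xs f)  ∎)
  where
  open ≤-Reasoning
  rearrange : ∀ a b c → a + b + c ≡ b + (c + a)
  rearrange = solve-∀

sum-nonzero-outside : (f : Fin n → ℕ) {xs : List (Fin n)} → Unique xs → sumOver xs f < sum f →
                      ∃ λ m → Outside m xs × ¬ f m ≡ 0
sum-nonzero-outside f {xs} xs-unique ∑xs<∑ with sum-nonzero (eraseAll xs f) erased≢0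
  where
  erased≢0 : ¬ sum (eraseAll xs f) ≡ 0
  erased≢0 ∑≡0 = <-irrefl (sym (trans (sum-eraseAll f xs-unique) (trans (cong (sumOver xs f +_) ∑≡0) (+-identityʳ (sumOver xs f))))) ∑xs<∑
... | m , fm≢0 with outside? m xs
...   | yes m∉xs = m , m∉xs , λ fm≡0 → fm≢0 (trans (eraseAll-outside f xs m∉xs) fm≡0)
...   | no ¬m∉xs = ⊥-elim (fm≢0 (eraseAll-inside f xs ¬m∉xs))

δ-refl : (a : Fin n) → δ a a ≡ 1
δ-refl a with a ≟ a
... | yes _   = refl
... | no a≢a = ⊥-elim (a≢a refl)

δ-≢ : {a b : Fin n} → ¬ a ≡ b → δ a b ≡ 0
δ-≢ {a = a} {b} a≢b with a ≟ b
... | yes a≡b = ⊥-elim (a≢b a≡b)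
... | no _    = refl

δ-iff : ∀ {m} {a b : Fin n} {c d : Fin m} → (a ≡ b → c ≡ d) → (c ≡ d → a ≡ b) → δ a b ≡ δ c d
δ-iff {a = a} {b} {c} {d} to from with a ≟ b | c ≟ d
... | yes _   | yes _   = refl
... | yes a≡b | no c≢d  = ⊥-elim (c≢d (to a≡b))
... | no a≢b  | yes c≡d = ⊥-elim (a≢b (from c≡d))
... | no _    | no _    = refl

δ≤1 : (a b : Fin n) → δ a b ≤ 1
δ≤1 a b with a ≟ b
... | yes _ = ≤-refl
... | no _  = z≤n

sum-δ : (a : Fin n) (g : Fin n → ℕ) → sum (λ m → δ a m * g m) ≡ g a
sum-δ a g = trans (sum-supported (λ m → δ a m * g m) ([] ∷ []) (λ { m (m≢a ∷ []) → cong (_* g m) (δ-≢ (m≢a ∘ sym)) }))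
                  (trans (cong (λ d → d * g a + 0) (δ-refl a)) (trans (+-identityʳ _) (+-identityʳ _)))

module FusionRingProperties {n : ℕ} (F : SDMFFusionRing n) where

  N≤1 : ∀ x y z → N F x y z ≤ 1
  N≤1 = multFree F

  N-0∨1 : ∀ x y z → N F x y z ≡ 0 ⊎ N F x y z ≡ 1
  N-0∨1 x y z = n≤1⇒n≡0∨n≡1 (N≤1 x y z)

  N-≢1 : ∀ {x y z} → ¬ N F x y z ≡ 1 → N F x y z ≡ 0
  N-≢1 {x} {y} {z} N≢1 with N-0∨1 x y z
  ... | inj₁ N≡0 = N≡0
  ... | inj₂ N≡1 = ⊥-elim (N≢1 N≡1)

  N-≢0 : ∀ {x y z} → ¬ N F x y z ≡ 0 → N F x y z ≡ 1
  N-≢0 {x} {y} {z} N≢0 with N-0∨1 x y z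
  ... | inj₁ N≡0 = ⊥-elim (N≢0 N≡0)
  ... | inj₂ N≡1 = N≡1

  N-rot : ∀ x y z → N F x y z ≡ N F y z x
  N-rot = dualRot F

  N-swap₂₃ : ∀ x y z → N F x y z ≡ N F x z y
  N-swap₂₃ x y z = trans (N-rot x y z) (trans (comm F y z x) (sym (N-rot x z y)))

  N-idem : ∀ x y z → N F x y z * N F x y z ≡ N F x y z
  N-idem x y z with N-0∨1 x y z
  ... | inj₁ N≡0 rewrite N≡0 = refl
  ... | inj₂ N≡1 rewrite N≡1 = refl

  N-self-unit : ∀ x → N F x x zero ≡ 1
  N-self-unit x = trans (dual₀ F x x) (δ-refl x)

  N-unit-≢ : ∀ {x y} → ¬ x ≡ y → N F x y zero ≡ 0
  N-unit-≢ x≢y = trans (dual₀ F _ _) (δ-≢ x≢y)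

  assoc-sum : ∀ i j k l → sum (λ m → N F i j m * N F m k l) ≡ sum (λ m → N F j k m * N F i m l)
  assoc-sum i j k l = trans (sym (ΣFin≡sum (suc n) (λ m → N F i j m * N F m k l)))
                        (trans (assoc F i j k l) (ΣFin≡sum (suc n) (λ m → N F j k m * N F i m l)))

  summands : Fin (suc n) → Fin (suc n) → ℕ
  summands x y = sum (N F x y)

  summands-unit : ∀ y → summands zero y ≡ 1
  summands-unit y = trans (sum-cong-≗ (unit F y)) (trans (sum-cong-≗ (λ m → sym (*-identityʳ (δ y m)))) (sum-δ y (λ _ → 1)))

  shared : Fin (suc n) → Fin (suc n) → Fin (suc n) → ℕ
  shared x y m = N F x x m * N F y y m

  -- The coefficient of X_x in X_x X_y X_y, computed with either bracketing.
  summands≡shared : ∀ x y → summands x y ≡ sum (shared x y)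
  summands≡shared x y = begin
    sum (N F x y)                           ≡⟨ sum-cong-≗ (λ m → sym (N-idem x y m)) ⟩
    sum (λ m → N F x y m * N F x y m)       ≡⟨ sum-cong-≗ (λ m → cong (N F x y m *_) (trans (N-rot m y x) (comm F y x m))) ⟨
    sum (λ m → N F x y m * N F m y x)       ≡⟨ assoc-sum x y y x ⟩
    sum (λ m → N F y y m * N F x m x)       ≡⟨ sum-cong-≗ (λ m → trans (cong (N F y y m *_) (N-swap₂₃ x m x)) (*-comm (N F y y m) (N F x x m))) ⟩
    sum (λ m → N F x x m * N F y y m)       ∎
    where open ≡-Reasoning

  -- Both sides count the constituents of X_x X_y X_z.
  sum-summands-assoc : ∀ x y z → sum (λ m → N F x y m * summands m z) ≡ sum (λ m → N F y z m * summands x m)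
  sum-summands-assoc x y z = begin
    sum (λ m → N F x y m * summands m z)                ≡⟨ sum-cong-≗ (λ m → *-distribˡ-sum (N F x y m) (N F m z)) ⟩
    sum (λ m → sum (λ l → N F x y m * N F m z l))       ≡⟨ ∑-comm (λ m l → N F x y m * N F m z l) ⟩
    sum (λ l → sum (λ m → N F x y m * N F m z l))       ≡⟨ sum-cong-≗ (assoc-sum x y z) ⟩
    sum (λ l → sum (λ m → N F y z m * N F x m l))       ≡⟨ ∑-comm (λ m l → N F y z m * N F x m l) ⟨
    sum (λ m → sum (λ l → N F y z m * N F x m l))       ≡⟨ sum-cong-≗ (λ m → *-distribˡ-sum (N F y z m) (N F x m)) ⟨
    sum (λ m → N F y z m * summands x m)                ∎
    where open ≡-Reasoning

  shared-unit : ∀ x y → shared x y zero ≡ 1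
  shared-unit x y = cong₂ _*_ (N-self-unit x) (N-self-unit y)

  summands-≥ : ∀ x y {xs} → Unique xs → All (λ m → shared x y m ≡ 1) xs → length xs ≤ summands x y
  summands-≥ x y {xs} xs-unique ones = subst (length xs ≤_) (sym (summands≡shared x y))
    (length≤sum (shared x y) xs-unique (All.map (≤-reflexive ∘ sym) ones))

  summands-≡ : ∀ x y {xs} → Unique xs → All (λ m → shared x y m ≡ 1) xs →
               (∀ m → Outside m xs → shared x y m ≡ 0) → summands x y ≡ length xs
  summands-≡ x y xs-unique ones zeros = trans (summands≡shared x y) (sum-indicator (shared x y) xs-unique ones zeros)

  1≤summands : ∀ x y → 1 ≤ summands x y
  1≤summands x y = summands-≥ x y ([] ∷ []) (shared-unit x y ∷ [])

module SymmetricTriangleFree {n : ℕ} (F : SDMFFusionRing n)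
  (N-sym : ∀ {x y} → ¬ x ≡ zero → ¬ y ≡ zero → N F x x y ≡ N F y y x)
  (no-triangle : ∀ {x y z} → ¬ x ≡ zero → ¬ y ≡ zero → ¬ z ≡ zero → ¬ x ≡ y → ¬ y ≡ z → ¬ x ≡ z →
                 N F x x y ≡ 1 → N F y y z ≡ 1 → N F x x z ≡ 1 → ⊥)
  where

  open FusionRingProperties F

  _∼_ : Fin (suc n) → Fin (suc n) → Set
  x ∼ y = N F x x y ≡ 1

  ∼-sym : ∀ {x y} → ¬ x ≡ zero → ¬ y ≡ zero → x ∼ y → y ∼ x
  ∼-sym x≢0 y≢0 x∼y = trans (sym (N-sym x≢0 y≢0)) x∼y

  N-xyx : ∀ {x y} → x ∼ y → N F x y x ≡ 1
  N-xyx {x} {y} x∼y = trans (N-swap₂₃ x y x) x∼y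

  N-xyy : ∀ {x y} → y ∼ x → N F x y y ≡ 1
  N-xyy {x} {y} y∼x = trans (N-rot x y y) y∼x

  no-common-neighbour : ∀ {x y m} → ¬ x ≡ zero → ¬ y ≡ zero → ¬ m ≡ zero → ¬ x ≡ y → ¬ x ≡ m → ¬ y ≡ m →
                        x ∼ y → shared x y m ≡ 0
  no-common-neighbour {x} {y} {m} x≢0 y≢0 m≢0 x≢y x≢m y≢m x∼y with N-0∨1 x x m | N-0∨1 y y m
  ... | inj₁ x≁m | _        = zero-* (N F y y m) x≁m
  ... | inj₂ _   | inj₁ y≁m = *-zero (N F x x m) y≁m
  ... | inj₂ x∼m | inj₂ y∼m = ⊥-elim (no-triangle x≢0 y≢0 m≢0 x≢y y≢m x≢m x∼y y∼m x∼m)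

  no-loopless-edge : ∀ {x y} → ¬ x ≡ zero → ¬ y ≡ zero → ¬ x ≡ y → x ∼ y → N F x x x ≡ 0 → N F y y y ≡ 0 → ⊥
  no-loopless-edge {x} {y} x≢0 y≢0 x≢y x∼y x-loopless y-loopless = <-irrefl refl (begin
    2              ≤⟨ length≤sum (N F x y) ((x≢y ∷ []) ∷ [] ∷ []) (one≤ (N-xyx x∼y) ∷ one≤ (N-xyy (∼-sym x≢0 y≢0 x∼y)) ∷ []) ⟩
    summands x y   ≡⟨ summands-≡ x y ([] ∷ []) (shared-unit x y ∷ []) only-unit ⟩
    1              ∎)
    where
    open ≤-Reasoning
    only-unit : ∀ m → Outside m (zero ∷ []) → shared x y m ≡ 0
    only-unit m (m≢0 ∷ []) with m ≟ x | m ≟ y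
    ... | yes refl | _        = zero-* (N F y y m) x-loopless
    ... | no _     | yes refl = *-zero (N F x x m) y-loopless
    ... | no m≢x   | no m≢y   = no-common-neighbour x≢0 y≢0 m≢0 x≢y (≢-sym m≢x) (≢-sym m≢y) x∼y

  -- Count X_a X_a X_v in two ways: at least 2, as X_a X_a ∋ 1, X_a; at most 1, as
  -- X_a X_x is a single basis element for every x outside {0, a, b}, including v.
  no-vertex-outside : ∀ {a b v} → ¬ a ≡ zero → ¬ b ≡ zero → ¬ v ≡ zero → ¬ v ≡ a → ¬ v ≡ b → a ∼ a →
                      (∀ {m} → ¬ m ≡ zero → ¬ m ≡ a → ¬ m ≡ b → N F a a m ≡ 0) →
                      (∀ {m} → ¬ m ≡ zero → ¬ m ≡ a → ¬ m ≡ b → N F b b m ≡ 0) →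
                      N F a v b ≡ 0 → ⊥
  no-vertex-outside {a} {b} {v} a≢0 b≢0 v≢0 v≢a v≢b a∼a a-neighbours b-neighbours avb≡0 = <-irrefl refl (begin
    2                                     ≤⟨ length≤sum (λ m → N F a a m * summands m v) ((≢-sym a≢0 ∷ []) ∷ [] ∷ [])
                                               (one≤ (trans (one-* _ (N-self-unit a)) (summands-unit v)) ∷
                                                subst (1 ≤_) (sym (one-* _ a∼a)) (1≤summands a v) ∷ []) ⟩
    sum (λ m → N F a a m * summands m v)  ≡⟨ sum-summands-assoc a a v ⟩
    sum (λ m → N F a v m * summands a m)  ≤⟨ sum-mono-≤ weighted≤ ⟩
    summands a v                          ≡⟨ summands-a-outside v≢0 v≢a v≢b ⟩
    1                                     ∎)
    where
    open ≤-Reasoning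
    summands-a-outside : ∀ {x} → ¬ x ≡ zero → ¬ x ≡ a → ¬ x ≡ b → summands a x ≡ 1
    summands-a-outside {x} x≢0 x≢a x≢b = summands-≡ a x ([] ∷ []) (shared-unit a x ∷ []) only-unit
      where
      only-unit : ∀ m → Outside m (zero ∷ []) → shared a x m ≡ 0
      only-unit m (m≢0 ∷ []) with m ≟ a | m ≟ b
      ... | yes refl | _        = *-zero (N F a a a) (trans (N-sym x≢0 a≢0) (a-neighbours x≢0 x≢a x≢b))
      ... | no _     | yes refl = *-zero (N F a a m) (trans (N-sym x≢0 b≢0) (b-neighbours x≢0 x≢a x≢b))
      ... | no m≢a   | no m≢b   = zero-* (N F x x m) (a-neighbours m≢0 m≢a m≢b)
    weighted≤ : ∀ m → N F a v m * summands a m ≤ N F a v m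
    weighted≤ m with N-0∨1 a v m
    ... | inj₁ avm≡0 = ≤-reflexive (trans (zero-* _ avm≡0) (sym avm≡0))
    ... | inj₂ avm≡1 with m ≟ zero | m ≟ a | m ≟ b
    ...   | yes refl | _        | _        = ⊥-elim (0≢1+n (trans (sym (N-unit-≢ (≢-sym v≢a))) avm≡1))
    ...   | no _     | yes refl | _        = ⊥-elim (0≢1+n (trans (sym (trans (N-swap₂₃ a v a) (a-neighbours v≢0 v≢a v≢b))) avm≡1))
    ...   | no _     | no _     | yes refl = ⊥-elim (0≢1+n (trans (sym avb≡0) avm≡1))
    ...   | no m≢0   | no m≢a   | no m≢b   = ≤-reflexive (trans (cong (N F a v m *_) (summands-a-outside m≢0 m≢a m≢b)) (*-identityʳ _))

  module LoopedLooplessEdge {a b} (a≢0 : ¬ a ≡ zero) (b≢0 : ¬ b ≡ zero) (a≢b : ¬ a ≡ b)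
                            (a∼a : a ∼ a) (b-loopless : N F b b b ≡ 0) (a∼b : a ∼ b) where

    b∼a : b ∼ a
    b∼a = ∼-sym a≢0 b≢0 a∼b

    summands-ab : summands a b ≡ 2
    summands-ab = summands-≡ a b ((≢-sym a≢0 ∷ []) ∷ [] ∷ []) (shared-unit a b ∷ cong₂ _*_ a∼a b∼a ∷ []) elsewhere
      where
      elsewhere : ∀ m → Outside m (zero ∷ a ∷ []) → shared a b m ≡ 0
      elsewhere m (m≢0 ∷ m≢a ∷ []) with m ≟ b
      ... | yes refl = *-zero (N F a a m) b-loopless
      ... | no m≢b   = no-common-neighbour a≢0 b≢0 m≢0 a≢b (≢-sym m≢a) (≢-sym m≢b) a∼b

    ab-constituents : ∀ m → Outside m (a ∷ b ∷ []) → N F a b m ≡ 0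
    ab-constituents = sum-saturated (N F a b) ((a≢b ∷ []) ∷ [] ∷ []) (N-xyx a∼b ∷ N-xyy b∼a ∷ []) summands-ab

    -- sum weight counts X_a X_a X_b; it exceeds sum (N F a a) by exactly 2.
    weight : Fin (suc n) → ℕ
    weight m = N F a a m * summands m b

    sum-weight : sum weight ≡ summands a a + 2
    sum-weight = begin
      sum weight                                                   ≡⟨ sum-summands-assoc a a b ⟩
      sum (λ m → N F a b m * summands a m)                         ≡⟨ sum-supported _ ((a≢b ∷ []) ∷ [] ∷ [])
                                                                        (λ m m∉ab → zero-* _ (ab-constituents m m∉ab)) ⟩
      N F a b a * summands a a + (N F a b b * summands a b + 0)    ≡⟨ cong₂ (λ u v → u + (v + 0)) (one-* _ (N-xyx a∼b))
                                                                        (trans (one-* _ (N-xyy b∼a)) summands-ab) ⟩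
      summands a a + 2                                             ∎
      where open ≡-Reasoning

    weight-excess : ∀ {xs} → Unique xs → sumOver xs weight ≤ 2 + sumOver xs (N F a a)
    weight-excess xs-unique = sum-excess (N F a a) weight 2 xs-unique sum-weight (λ m _ → ≤-*-pos _ (1≤summands m b))

    weight-a : weight a ≡ 2
    weight-a = trans (one-* _ a∼a) summands-ab

    a-neighbours : ∀ {m} → ¬ m ≡ zero → ¬ m ≡ a → ¬ m ≡ b → N F a a m ≡ 0
    a-neighbours {m} m≢0 m≢a m≢b with N-0∨1 a a m
    ... | inj₁ a≁m = a≁m
    ... | inj₂ a∼m = ⊥-elim (<-irrefl refl (begin
      6                                       ≤⟨ sumOver-bounds weight (≤-reflexive (sym weight-a) ∷ 2≤weight-b ∷ 2≤weight-m ∷ []) ⟩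
      sumOver (a ∷ b ∷ m ∷ []) weight         ≤⟨ weight-excess ((a≢b ∷ ≢-sym m≢a ∷ []) ∷ (≢-sym m≢b ∷ []) ∷ [] ∷ []) ⟩
      2 + sumOver (a ∷ b ∷ m ∷ []) (N F a a)  ≡⟨ cong (2 +_) (sumOver-values (N F a a) (a∼a ∷ a∼b ∷ a∼m ∷ [])) ⟩
      5                                       ∎))
      where
      open ≤-Reasoning
      2≤weight-b : 2 ≤ weight b
      2≤weight-b = subst (2 ≤_) (sym (one-* _ a∼b))
        (summands-≥ b b ((≢-sym a≢0 ∷ []) ∷ [] ∷ []) (shared-unit b b ∷ cong₂ _*_ b∼a b∼a ∷ []))
      2≤weight-m : 2 ≤ weight m
      2≤weight-m = subst (2 ≤_) (sym (one-* _ a∼m))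
        (summands-≥ m b ((≢-sym a≢0 ∷ []) ∷ [] ∷ []) (shared-unit m b ∷ cong₂ _*_ (∼-sym a≢0 m≢0 a∼m) b∼a ∷ []))

    b-neighbours : ∀ {m} → ¬ m ≡ zero → ¬ m ≡ a → ¬ m ≡ b → N F b b m ≡ 0
    b-neighbours {m} m≢0 m≢a m≢b with N-0∨1 b b m
    ... | inj₁ b≁m = b≁m
    ... | inj₂ b∼m = ⊥-elim (<-irrefl refl (begin
      5                                    ≤⟨ sumOver-bounds weight (≤-reflexive (sym weight-a) ∷ 3≤weight-b ∷ []) ⟩
      sumOver (a ∷ b ∷ []) weight          ≤⟨ weight-excess ((a≢b ∷ []) ∷ [] ∷ []) ⟩
      2 + sumOver (a ∷ b ∷ []) (N F a a)   ≡⟨ cong (2 +_) (sumOver-values (N F a a) (a∼a ∷ a∼b ∷ [])) ⟩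
      4                                    ∎))
      where
      open ≤-Reasoning
      3≤weight-b : 3 ≤ weight b
      3≤weight-b = subst (3 ≤_) (sym (one-* _ a∼b))
        (summands-≥ b b ((≢-sym a≢0 ∷ ≢-sym m≢0 ∷ []) ∷ (≢-sym m≢a ∷ []) ∷ [] ∷ [])
          (shared-unit b b ∷ cong₂ _*_ b∼a b∼a ∷ cong₂ _*_ b∼m b∼m ∷ []))

  summands-looped-edge : ∀ {a b} → ¬ a ≡ zero → ¬ b ≡ zero → ¬ a ≡ b → a ∼ a → b ∼ b → a ∼ b → summands a b ≡ 3
  summands-looped-edge {a} {b} a≢0 b≢0 a≢b a∼a b∼b a∼b =
    summands-≡ a b ((≢-sym a≢0 ∷ ≢-sym b≢0 ∷ []) ∷ (a≢b ∷ []) ∷ [] ∷ [])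
      (shared-unit a b ∷ cong₂ _*_ a∼a (∼-sym a≢0 b≢0 a∼b) ∷ cong₂ _*_ a∼b b∼b ∷ [])
      (λ { m (m≢0 ∷ m≢a ∷ m≢b ∷ []) → no-common-neighbour a≢0 b≢0 m≢0 a≢b (≢-sym m≢a) (≢-sym m≢b) a∼b })

  record LoopedEdge : Set where
    field
      a b k       : Fin (suc n)
      a≢0         : ¬ a ≡ zero
      b≢0         : ¬ b ≡ zero
      k≢0         : ¬ k ≡ zero
      a≢b         : ¬ a ≡ b
      k≢a         : ¬ k ≡ a
      k≢b         : ¬ k ≡ b
      a∼a         : a ∼ a
      b∼b         : b ∼ b
      a∼b         : a ∼ b
      k∈a⊗b       : N F a b k ≡ 1

    b∼a : b ∼ a
    b∼a = ∼-sym a≢0 b≢0 a∼b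

    summands-ab : summands a b ≡ 3
    summands-ab = summands-looped-edge a≢0 b≢0 a≢b a∼a b∼b a∼b

    ab-constituents : ∀ m → Outside m (a ∷ b ∷ k ∷ []) → N F a b m ≡ 0
    ab-constituents = sum-saturated (N F a b) ((a≢b ∷ ≢-sym k≢a ∷ []) ∷ (≢-sym k≢b ∷ []) ∷ [] ∷ [])
                        (N-xyx a∼b ∷ N-xyy b∼a ∷ k∈a⊗b ∷ []) summands-ab

    -- weight ≥ bound away from 0 and sum weight = sum bound + 3; evaluating both
    -- on a few points confines the neighbourhoods of a and b.
    weight bound : Fin (suc n) → ℕ
    weight m = N F a a m * summands m b
    bound  m = N F a a m * (1 + N F k k m)

    sum-bound : sum bound ≡ summands a a + summands a k
    sum-bound = begin
      sum bound                                     ≡⟨ sum-cong-≗ (λ m → *-distribˡ-+ (N F a a m) 1 (N F k k m)) ⟩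
      sum (λ m → N F a a m * 1 + shared a k m)      ≡⟨ ∑-distrib-+ (λ m → N F a a m * 1) (shared a k) ⟩
      sum (λ m → N F a a m * 1) + sum (shared a k)  ≡⟨ cong₂ _+_ (sum-cong-≗ (λ m → *-identityʳ (N F a a m))) (sym (summands≡shared a k)) ⟩
      summands a a + summands a k                   ∎
      where open ≡-Reasoning

    sum-weight : sum weight ≡ sum bound + 3
    sum-weight = begin
      sum weight                                                    ≡⟨ sum-summands-assoc a a b ⟩
      sum (λ m → N F a b m * summands a m)                          ≡⟨ sum-supported (λ m → N F a b m * summands a m) ((a≢b ∷ ≢-sym k≢a ∷ []) ∷ (≢-sym k≢b ∷ []) ∷ [] ∷ [])
                                                                         (λ m m∉abk → zero-* (summands a m) (ab-constituents m m∉abk)) ⟩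
      sumOver (a ∷ b ∷ k ∷ []) (λ m → N F a b m * summands a m)     ≡⟨ sumOver-values (λ m → N F a b m * summands a m) (one-* _ (N-xyx a∼b) ∷
                                                                         trans (one-* _ (N-xyy b∼a)) summands-ab ∷ one-* _ k∈a⊗b ∷ []) ⟩
      summands a a + (3 + (summands a k + 0))                       ≡⟨ rearrange (summands a a) (summands a k) ⟩
      summands a a + summands a k + 3                               ≡⟨ cong (_+ 3) sum-bound ⟨
      sum bound + 3                                                 ∎
      where
      open ≡-Reasoning
      rearrange : ∀ x y → x + (3 + (y + 0)) ≡ x + y + 3
      rearrange = solve-∀

    bound≤weight : ∀ {m} → ¬ m ≡ zero → bound m ≤ weight m
    bound≤weight {m} m≢0 with N-0∨1 a a m
    ... | inj₁ a≁m = subst (_≤ weight m) (sym (zero-* _ a≁m)) z≤n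
    ... | inj₂ a∼m = subst₂ _≤_ (sym (one-* _ a∼m)) (sym (one-* _ a∼m)) (≤-trans (s≤s (N≤1 k k m))
                       (summands-≥ m b ((≢-sym a≢0 ∷ []) ∷ [] ∷ []) (shared-unit m b ∷ cong₂ _*_ (∼-sym a≢0 m≢0 a∼m) b∼a ∷ [])))

    weight-excess : ∀ {xs} → Unique (zero ∷ xs) → sumOver (zero ∷ xs) weight ≤ 3 + sumOver (zero ∷ xs) bound
    weight-excess xs-unique = sum-excess bound weight 3 xs-unique sum-weight (λ { m (m≢0 ∷ _) → bound≤weight m≢0 })

    weight-0 : weight zero ≡ 1
    weight-0 = trans (one-* _ (N-self-unit a)) (summands-unit b)

    bound-0 : bound zero ≡ 2
    bound-0 = trans (one-* _ (N-self-unit a)) (cong suc (N-self-unit k))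

    weight-a : weight a ≡ 3
    weight-a = trans (one-* _ a∼a) summands-ab

    bound-a : bound a ≡ 1 + N F k k a
    bound-a = one-* _ a∼a

    weight-b : weight b ≡ summands b b
    weight-b = one-* _ a∼b

    bound-b : bound b ≡ 1 + N F k k b
    bound-b = one-* _ a∼b

    ThirdIsolated : Set
    ThirdIsolated = N F k k a ≡ 0 × N F k k b ≡ 0

  swap : LoopedEdge → LoopedEdge
  swap E = record
    { a = b ; b = a ; k = k
    ; a≢0 = b≢0 ; b≢0 = a≢0 ; k≢0 = k≢0
    ; a≢b = ≢-sym a≢b ; k≢a = k≢b ; k≢b = k≢a
    ; a∼a = b∼b ; b∼b = a∼a ; a∼b = b∼a
    ; k∈a⊗b = trans (comm F b a k) k∈a⊗b
    }
    where open LoopedEdge E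

  module _ (E : LoopedEdge) where
    open LoopedEdge E
    private
      module Y = LoopedEdge (swap E)
      0≢a : ¬ zero ≡ a
      0≢a = ≢-sym a≢0
      0≢b : ¬ zero ≡ b
      0≢b = ≢-sym b≢0
      0≢k : ¬ zero ≡ k
      0≢k = ≢-sym k≢0
      b≢a : ¬ b ≡ a
      b≢a = ≢-sym a≢b
      a≢k : ¬ a ≡ k
      a≢k = ≢-sym k≢a
      b≢k : ¬ b ≡ k
      b≢k = ≢-sym k≢b

    -- Then a's neighbours are a, b, k and b's are a, b, which gives sum weight = 9
    -- but sum bound + 3 = 10.
    private module ThirdAdjacentToAAlone (k∼a : k ∼ a) (k≁b : N F k k b ≡ 0) where
      a∼k : a ∼ k
      a∼k = ∼-sym k≢0 a≢0 k∼a
      k∼k : k ∼ k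
      k∼k with N-0∨1 k k k
      ... | inj₂ k∼k        = k∼k
      ... | inj₁ k-loopless = ⊥-elim (0≢1+n (trans (sym (LoopedLooplessEdge.a-neighbours a≢0 k≢0 a≢k a∼a k-loopless a∼k b≢0 b≢a b≢k)) a∼b))

      a-neighbours : ∀ {m} → ¬ m ≡ zero → ¬ m ≡ a → ¬ m ≡ b → ¬ m ≡ k → N F a a m ≡ 0
      a-neighbours {m} m≢0 m≢a m≢b m≢k with N-0∨1 a a m
      ... | inj₁ a≁m = a≁m
      ... | inj₂ a∼m = ⊥-elim (<-irrefl refl (begin
        9                                       ≤⟨ sumOver-bounds Y.weight (≤-reflexive (sym Y.weight-0) ∷ ≤-reflexive (sym Y.weight-a) ∷ 5≤Y-weight-a ∷ []) ⟩
        sumOver (zero ∷ b ∷ a ∷ []) Y.weight     ≤⟨ Y.weight-excess ((0≢b ∷ 0≢a ∷ []) ∷ (b≢a ∷ []) ∷ [] ∷ []) ⟩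
        3 + sumOver (zero ∷ b ∷ a ∷ []) Y.bound  ≡⟨ cong (3 +_) (sumOver-values Y.bound
                                                     (Y.bound-0 ∷ trans Y.bound-a (cong suc k≁b) ∷ trans Y.bound-b (cong suc k∼a) ∷ [])) ⟩
        8                                       ∎))
        where
        open ≤-Reasoning
        5≤Y-weight-a : 5 ≤ Y.weight a
        5≤Y-weight-a = subst (5 ≤_) (sym Y.weight-b) (length≤sum (N F a a)
          ((0≢a ∷ 0≢b ∷ 0≢k ∷ ≢-sym m≢0 ∷ []) ∷ (a≢b ∷ a≢k ∷ ≢-sym m≢a ∷ []) ∷ (b≢k ∷ ≢-sym m≢b ∷ []) ∷ (≢-sym m≢k ∷ []) ∷ [] ∷ [])
          (one≤ (N-self-unit a) ∷ one≤ a∼a ∷ one≤ a∼b ∷ one≤ a∼k ∷ one≤ a∼m ∷ []))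

      b-neighbours : ∀ {m} → ¬ m ≡ zero → ¬ m ≡ a → ¬ m ≡ b → N F b b m ≡ 0
      b-neighbours {m} m≢0 m≢a m≢b with N-0∨1 b b m
      ... | inj₁ b≁m = b≁m
      ... | inj₂ b∼m = ⊥-elim (<-irrefl refl (begin
        10 + N F k k m                               ≡⟨ cong (10 +_) (+-identityʳ _) ⟨
        1 + (3 + (4 + (2 + N F k k m + 0)))          ≤⟨ sumOver-bounds Y.weight (≤-reflexive (sym Y.weight-0) ∷ ≤-reflexive (sym Y.weight-a) ∷
                                                          subst (4 ≤_) (sym Y.weight-b) 4≤summands-aa ∷
                                                          subst (2 + N F k k m ≤_) (sym (one-* _ b∼m)) summands-ma ∷ []) ⟩
        sumOver (zero ∷ b ∷ a ∷ m ∷ []) Y.weight      ≤⟨ Y.weight-excess ((0≢b ∷ 0≢a ∷ ≢-sym m≢0 ∷ []) ∷ (b≢a ∷ ≢-sym m≢b ∷ []) ∷ (≢-sym m≢a ∷ []) ∷ [] ∷ []) ⟩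
        3 + sumOver (zero ∷ b ∷ a ∷ m ∷ []) Y.bound   ≡⟨ cong (3 +_) (sumOver-values Y.bound (Y.bound-0 ∷ trans Y.bound-a (cong suc k≁b) ∷
                                                          trans Y.bound-b (cong suc k∼a) ∷ one-* _ b∼m ∷ [])) ⟩
        9 + (N F k k m + 0)                           ≡⟨ cong (9 +_) (+-identityʳ _) ⟩
        9 + N F k k m                                 ∎))
        where
        open ≤-Reasoning
        4≤summands-aa : 4 ≤ summands a a
        4≤summands-aa = length≤sum (N F a a) ((0≢a ∷ 0≢b ∷ 0≢k ∷ []) ∷ (a≢b ∷ a≢k ∷ []) ∷ (b≢k ∷ []) ∷ [] ∷ [])
          (one≤ (N-self-unit a) ∷ one≤ a∼a ∷ one≤ a∼b ∷ one≤ a∼k ∷ [])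
        m∼b : m ∼ b
        m∼b = ∼-sym b≢0 m≢0 b∼m
        summands-ma : 2 + N F k k m ≤ summands m a
        summands-ma with N-0∨1 k k m
        ... | inj₁ k≁m rewrite k≁m = summands-≥ m a ((0≢b ∷ []) ∷ [] ∷ []) (shared-unit m a ∷ cong₂ _*_ m∼b a∼b ∷ [])
        ... | inj₂ k∼m rewrite k∼m = summands-≥ m a ((0≢b ∷ 0≢k ∷ []) ∷ (b≢k ∷ []) ∷ [] ∷ [])
                                        (shared-unit m a ∷ cong₂ _*_ m∼b a∼b ∷ cong₂ _*_ (∼-sym k≢0 m≢0 k∼m) a∼k ∷ [])

      summands-bb : summands b b ≡ 3
      summands-bb = sum-indicator (N F b b) ((0≢a ∷ 0≢b ∷ []) ∷ (a≢b ∷ []) ∷ [] ∷ [])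
        (N-self-unit b ∷ b∼a ∷ b∼b ∷ []) (λ { m (m≢0 ∷ m≢a ∷ m≢b ∷ []) → b-neighbours m≢0 m≢a m≢b })

      summands-kb : summands k b ≡ 2
      summands-kb = summands-≡ k b ((0≢a ∷ []) ∷ [] ∷ []) (shared-unit k b ∷ cong₂ _*_ k∼a b∼a ∷ []) elsewhere
        where
        elsewhere : ∀ m → Outside m (zero ∷ a ∷ []) → shared k b m ≡ 0
        elsewhere m (m≢0 ∷ m≢a ∷ []) with m ≟ b
        ... | yes refl = zero-* (N F m m m) k≁b
        ... | no m≢b   = *-zero (N F k k m) (b-neighbours m≢0 m≢a m≢b)

      abk-unique : Unique (zero ∷ a ∷ b ∷ k ∷ [])
      abk-unique = (0≢a ∷ 0≢b ∷ 0≢k ∷ []) ∷ (a≢b ∷ a≢k ∷ []) ∷ (b≢k ∷ []) ∷ [] ∷ []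

      outside-abk : ∀ (f : Fin (suc n) → ℕ) → (∀ m → N F a a m ≡ 0 → f m ≡ 0) → ∀ m → Outside m (zero ∷ a ∷ b ∷ k ∷ []) → f m ≡ 0
      outside-abk f f≡0 m (m≢0 ∷ m≢a ∷ m≢b ∷ m≢k ∷ []) = f≡0 m (a-neighbours m≢0 m≢a m≢b m≢k)

      sum-weight≡9 : sum weight ≡ 9
      sum-weight≡9 = trans (sum-supported weight abk-unique (outside-abk weight (λ m → zero-* (summands m b))))
        (sumOver-values weight (weight-0 ∷ weight-a ∷ trans weight-b summands-bb ∷ trans (one-* _ a∼k) summands-kb ∷ []))

      sum-bound≡7 : sum bound ≡ 7
      sum-bound≡7 = trans (sum-supported bound abk-unique (outside-abk bound (λ m → zero-* (1 + N F k k m))))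
        (sumOver-values bound (bound-0 ∷ trans bound-a (cong suc k∼a) ∷ trans bound-b (cong suc k≁b) ∷ trans (one-* _ a∼k) (cong suc k∼k) ∷ []))

    third-not-adjacent-to-a-alone : k ∼ a → N F k k b ≡ 0 → ⊥
    third-not-adjacent-to-a-alone k∼a k≁b = 1+n≢n (begin
      10             ≡⟨ cong (_+ 3) sum-bound≡7 ⟨
      sum bound + 3  ≡⟨ sum-weight ⟨
      sum weight     ≡⟨ sum-weight≡9 ⟩
      9              ∎)
      where
      open ThirdAdjacentToAAlone k∼a k≁b
      open ≡-Reasoning

    isolated-third-edge-neighbours : ThirdIsolated → ∀ {m} → ¬ m ≡ zero → ¬ m ≡ a → ¬ m ≡ b → N F a a m ≡ 0
    isolated-third-edge-neighbours (k≁a , k≁b) {m} m≢0 m≢a m≢b with N-0∨1 a a m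
    ... | inj₁ a≁m = a≁m
    ... | inj₂ a∼m = ⊥-elim (<-irrefl refl (begin
      8                                       ≤⟨ sumOver-bounds Y.weight (≤-reflexive (sym Y.weight-0) ∷ ≤-reflexive (sym Y.weight-a) ∷
                                                    subst (4 ≤_) (sym Y.weight-b) 4≤summands-aa ∷ []) ⟩
      sumOver (zero ∷ b ∷ a ∷ []) Y.weight     ≤⟨ Y.weight-excess ((0≢b ∷ 0≢a ∷ []) ∷ (b≢a ∷ []) ∷ [] ∷ []) ⟩
      3 + sumOver (zero ∷ b ∷ a ∷ []) Y.bound  ≡⟨ cong (3 +_) (sumOver-values Y.bound
                                                   (Y.bound-0 ∷ trans Y.bound-a (cong suc k≁b) ∷ trans Y.bound-b (cong suc k≁a) ∷ [])) ⟩
      7                                       ∎))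
      where
      open ≤-Reasoning
      4≤summands-aa : 4 ≤ summands a a
      4≤summands-aa = length≤sum (N F a a)
        ((0≢a ∷ 0≢b ∷ ≢-sym m≢0 ∷ []) ∷ (a≢b ∷ ≢-sym m≢a ∷ []) ∷ (≢-sym m≢b ∷ []) ∷ [] ∷ [])
        (one≤ (N-self-unit a) ∷ one≤ a∼a ∷ one≤ a∼b ∷ one≤ a∼m ∷ [])

    isolated-third-summands : ThirdIsolated → summands a k ≡ 1
    isolated-third-summands isolated@(k≁a , k≁b) = summands-≡ a k ([] ∷ []) (shared-unit a k ∷ []) elsewhere
      where
      elsewhere : ∀ m → Outside m (zero ∷ []) → shared a k m ≡ 0
      elsewhere m (m≢0 ∷ []) with m ≟ a | m ≟ b
      ... | yes refl | _        = *-zero (N F m m m) k≁a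
      ... | no _     | yes refl = *-zero (N F a a m) k≁b
      ... | no m≢a   | no m≢b   = zero-* (N F k k m) (isolated-third-edge-neighbours isolated m≢0 m≢a m≢b)

  module _ (E : LoopedEdge) (isolated : LoopedEdge.ThirdIsolated E) where
    open LoopedEdge E

    third-isolated : ∀ {m} → ¬ m ≡ zero → N F k k m ≡ 0
    third-isolated {m} m≢0 with N-0∨1 k k m
    ... | inj₁ k≁m = k≁m
    ... | inj₂ k∼m = ⊥-elim (<-irrefl refl (begin
      2                                    ≤⟨ length≤sum (λ x → N F k k x * summands a x) ((≢-sym m≢0 ∷ []) ∷ [] ∷ [])
                                                (weighted-pos (N-self-unit k) ∷ weighted-pos k∼m ∷ []) ⟩
      sum (λ x → N F k k x * summands a x)  ≡⟨ sum-summands-assoc a k k ⟨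
      sum (λ x → N F a k x * summands x k)  ≡⟨ sum-supported _ ([] ∷ []) (λ x x∉b → zero-* (summands x k) (ak-constituents x x∉b)) ⟩
      N F a k b * summands b k + 0          ≡⟨ cong (_+ 0) (one-* _ akb) ⟩
      summands b k + 0                      ≡⟨ +-identityʳ _ ⟩
      summands b k                          ≡⟨ isolated-third-summands (swap E) (Data.Product.swap isolated) ⟩
      1                                     ∎))
      where
      open ≤-Reasoning
      weighted-pos : ∀ {x} → N F k k x ≡ 1 → 1 ≤ N F k k x * summands a x
      weighted-pos {x} k∼x = subst (1 ≤_) (sym (one-* _ k∼x)) (1≤summands a x)
      akb : N F a k b ≡ 1
      akb = trans (N-swap₂₃ a k b) k∈a⊗b
      ak-constituents : ∀ x → Outside x (b ∷ []) → N F a k x ≡ 0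
      ak-constituents = sum-saturated (N F a k) ([] ∷ []) (akb ∷ []) (isolated-third-summands E isolated)

    no-fourth-vertex : ∀ {v} → ¬ v ≡ zero → ¬ v ≡ a → ¬ v ≡ b → ¬ v ≡ k → ⊥
    no-fourth-vertex {v} v≢0 v≢a v≢b v≢k =
      no-vertex-outside a≢0 b≢0 v≢0 v≢a v≢b a∼a
        (isolated-third-edge-neighbours E isolated)
        (λ m≢0 m≢a m≢b → isolated-third-edge-neighbours (swap E) (Data.Product.swap isolated) m≢0 m≢b m≢a)
        (trans (N-swap₂₃ a v b) (ab-constituents v (v≢a ∷ v≢b ∷ v≢k ∷ [])))

record BooleanGroup (n : ℕ) : Set where
  infixl 7 _∙_
  field
    _∙_            : Fin (suc n) → Fin (suc n) → Fin (suc n)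
    ∙-assoc        : ∀ x y z → x ∙ y ∙ z ≡ x ∙ (y ∙ z)
    ∙-comm         : ∀ x y → x ∙ y ≡ y ∙ x
    ∙-identityˡ    : ∀ x → zero ∙ x ≡ x
    ∙-self-inverse : ∀ x → x ∙ x ≡ zero

  cancelˡ : ∀ g x → g ∙ (g ∙ x) ≡ x
  cancelˡ g x = trans (sym (∙-assoc g g x)) (trans (cong (_∙ x) (∙-self-inverse g)) (∙-identityˡ x))

  rotate : ∀ {x y z} → x ∙ y ≡ z → y ∙ z ≡ x
  rotate {x} {y} refl = trans (cong (y ∙_) (∙-comm x y)) (cancelˡ y x)

  swap-left : ∀ g x y → x ∙ (g ∙ y) ≡ g ∙ (x ∙ y)
  swap-left g x y = trans (sym (∙-assoc x g y)) (trans (cong (_∙ y) (∙-comm x g)) (∙-assoc g x y))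

module BasisGroup {n : ℕ} (F : SDMFFusionRing n) (squares-trivial : ∀ x m → ¬ m ≡ zero → N F x x m ≡ 0) where
  open FusionRingProperties F

  summands≡1 : ∀ x y → summands x y ≡ 1
  summands≡1 x y = summands-≡ x y ([] ∷ []) (shared-unit x y ∷ [])
    (λ { m (m≢0 ∷ []) → zero-* (N F y y m) (squares-trivial x m m≢0) })

  constituent : ∀ x y → ∃ λ m → N F x y m ≡ 1
  constituent x y with sum-nonzero (N F x y) (λ ∑≡0 → 0≢1+n (trans (sym ∑≡0) (summands≡1 x y)))
  ... | m , N≢0 with N-0∨1 x y m
  ...   | inj₁ N≡0 = ⊥-elim (N≢0 N≡0)
  ...   | inj₂ N≡1 = m , N≡1

  infixl 7 _∙_
  _∙_ : Fin (suc n) → Fin (suc n) → Fin (suc n)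
  x ∙ y = proj₁ (constituent x y)

  ∙-constituent : ∀ x y → N F x y (x ∙ y) ≡ 1
  ∙-constituent x y = proj₂ (constituent x y)

  other-constituents : ∀ x y m → Outside m (x ∙ y ∷ []) → N F x y m ≡ 0
  other-constituents x y = sum-saturated (N F x y) ([] ∷ []) (∙-constituent x y ∷ []) (summands≡1 x y)

  constituent-unique : ∀ x y l → N F x y l ≡ 1 → l ≡ x ∙ y
  constituent-unique x y l N≡1 with l ≟ x ∙ y
  ... | yes l≡x∙y = l≡x∙y
  ... | no l≢x∙y  = ⊥-elim (0≢1+n (trans (sym (other-constituents x y l (l≢x∙y ∷ []))) N≡1))

  sum-collapse : ∀ x y (g : Fin (suc n) → ℕ) → sum (λ m → N F x y m * g m) ≡ g (x ∙ y)
  sum-collapse x y g =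
    trans (sum-supported (λ m → N F x y m * g m) ([] ∷ []) (λ m m∉ → zero-* (g m) (other-constituents x y m m∉)))
          (trans (cong (_+ 0) (one-* _ (∙-constituent x y))) (+-identityʳ _))

  booleanGroup : BooleanGroup n
  booleanGroup = record
    { _∙_          = _∙_
    ; ∙-assoc        = λ x y z → constituent-unique x (y ∙ z) (x ∙ y ∙ z) (begin
                       N F x (y ∙ z) (x ∙ y ∙ z)                   ≡⟨ sum-collapse y z (λ m → N F x m (x ∙ y ∙ z)) ⟨
                       sum (λ m → N F y z m * N F x m (x ∙ y ∙ z))  ≡⟨ assoc-sum x y z (x ∙ y ∙ z) ⟨
                       sum (λ m → N F x y m * N F m z (x ∙ y ∙ z))  ≡⟨ sum-collapse x y (λ m → N F m z (x ∙ y ∙ z)) ⟩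
                       N F (x ∙ y) z (x ∙ y ∙ z)                   ≡⟨ ∙-constituent (x ∙ y) z ⟩
                       1                                           ∎)
    ; ∙-comm         = λ x y → constituent-unique y x (x ∙ y) (trans (comm F y x (x ∙ y)) (∙-constituent x y))
    ; ∙-identityˡ    = λ x → sym (constituent-unique zero x x (trans (unit F x x) (δ-refl x)))
    ; ∙-self-inverse = λ x → sym (constituent-unique x x zero (N-self-unit x))
    }
    where open ≡-Reasoning

module BooleanGroupOrder {n : ℕ} (G : BooleanGroup n) where
  open BooleanGroup G

  Part : Set
  Part = Fin (suc n) → Bool

  ∣_∣ : Part → ℕ
  ∣ H ∣ = sum (λ x → indicator (H x))

  Closed : Part → Set
  Closed H = ∀ x y → T (H x) → T (H y) → T (H (x ∙ y))

  size≤order : ∀ H → ∣ H ∣ ≤ suc n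
  size≤order H = subst (∣ H ∣ ≤_) (sum-ones (suc n)) (sum-mono-≤ (λ x → indicator≤1 (H x)))

  size-full : ∀ H → (∀ x → T (H x)) → ∣ H ∣ ≡ suc n
  size-full H full = trans (sum-cong-≗ (λ x → cong indicator (Equivalence.to T-≡ (full x)))) (sum-ones (suc n))

  size-translate : ∀ H g → ∣ (λ x → H (g ∙ x)) ∣ ≡ ∣ H ∣
  size-translate H g = sym (∑-permute (λ x → indicator (H x)) (permutation (g ∙_) (g ∙_) (cancelˡ g) (cancelˡ g)))

  _∪_·_ : Part → Fin (suc n) → Part → Part
  (H ∪ g · H′) x = H x ∨ H′ (g ∙ x)

  module _ {H : Part} (closed : Closed H) {g : Fin (suc n)} (g∉H : ¬ T (H g)) where

    disjoint-translate : ∀ x → T (H x) → T (H (g ∙ x)) → ⊥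
    disjoint-translate x x∈H gx∈H = g∉H (subst (T ∘ H) g∙x∙x≡g (closed x (g ∙ x) x∈H gx∈H))
      where
      g∙x∙x≡g : x ∙ (g ∙ x) ≡ g
      g∙x∙x≡g = trans (swap-left g x x) (trans (cong (g ∙_) (∙-self-inverse x)) (trans (∙-comm g zero) (∙-identityˡ g)))

    extend-closed : Closed (H ∪ g · H)
    extend-closed x y x∈ y∈ with Equivalence.to T-∨ x∈ | Equivalence.to T-∨ y∈
    ... | inj₁ x∈H  | inj₁ y∈H  = Equivalence.from T-∨ (inj₁ (closed x y x∈H y∈H))
    ... | inj₁ x∈H  | inj₂ gy∈H = Equivalence.from T-∨ (inj₂ (subst (T ∘ H) (swap-left g x y) (closed x (g ∙ y) x∈H gy∈H)))
    ... | inj₂ gx∈H | inj₁ y∈H  = Equivalence.from T-∨ (inj₂ (subst (T ∘ H) (∙-assoc g x y) (closed (g ∙ x) y gx∈H y∈H)))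
    ... | inj₂ gx∈H | inj₂ gy∈H = Equivalence.from T-∨ (inj₁ (subst (T ∘ H) gx∙gy≡x∙y (closed (g ∙ x) (g ∙ y) gx∈H gy∈H)))
      where
      gx∙gy≡x∙y : g ∙ x ∙ (g ∙ y) ≡ x ∙ y
      gx∙gy≡x∙y = trans (∙-assoc g x (g ∙ y)) (trans (cong (g ∙_) (swap-left g x y)) (cancelˡ g (x ∙ y)))

    extend-size : ∣ H ∪ g · H ∣ ≡ ∣ H ∣ + ∣ H ∣
    extend-size = trans (sum-cong-≗ indicator-∨)
      (trans (∑-distrib-+ (λ x → indicator (H x)) (λ x → indicator (H (g ∙ x)))) (cong (∣ H ∣ +_) (size-translate H g)))
      where
      indicator-∨ : ∀ x → indicator (H x ∨ H (g ∙ x)) ≡ indicator (H x) + indicator (H (g ∙ x))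
      indicator-∨ x with H x in x∈H | H (g ∙ x) in gx∈H
      ... | true  | true  = ⊥-elim (disjoint-translate x (Equivalence.from T-≡ x∈H) (Equivalence.from T-≡ gx∈H))
      ... | true  | false = refl
      ... | false | true  = refl
      ... | false | false = refl

  -- Adjoining a translate g · H with g ∉ H doubles a closed set; starting from {0}
  -- this exhausts the group. fuel only bounds the number of steps.
  grow : ∀ fuel H t → Closed H → ∣ H ∣ ≡ 2 ^ t → suc n ≤ ∣ H ∣ + fuel → ∃ λ k → suc n ≡ 2 ^ k
  grow zero H t _ size bound = t , trans (≤-antisym (subst (suc n ≤_) (+-identityʳ _) bound) (size≤order H)) size
  grow (suc fuel) H t closed size bound with all? (λ x → T? (H x))
  ... | yes full = t , trans (sym (size-full H full)) size
  ... | no ¬full with ¬∀⟶∃¬ _ (λ x → T (H x)) (λ x → T? (H x)) ¬full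
  ...   | g , g∉H = grow fuel (H ∪ g · H) (suc t) (extend-closed closed g∉H) size′ bound′
    where
    size′ : ∣ H ∪ g · H ∣ ≡ 2 ^ suc t
    size′ = trans (extend-size closed g∉H) (trans (cong₂ _+_ size size) (cong (2 ^ t +_) (sym (+-identityʳ _))))
    bound′ : suc n ≤ ∣ H ∪ g · H ∣ + fuel
    bound′ = begin
      suc n                        ≤⟨ bound ⟩
      ∣ H ∣ + suc fuel             ≤⟨ +-monoʳ-≤ ∣ H ∣ (+-monoˡ-≤ fuel (subst (1 ≤_) (sym size) (m^n>0 2 t))) ⟩
      ∣ H ∣ + (∣ H ∣ + fuel)       ≡⟨ +-assoc ∣ H ∣ ∣ H ∣ fuel ⟨
      ∣ H ∣ + ∣ H ∣ + fuel         ≡⟨ cong (_+ fuel) (extend-size closed g∉H) ⟨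
      ∣ H ∪ g · H ∣ + fuel         ∎
      where open ≤-Reasoning

  order-power-of-two : ∃ λ k → suc n ≡ 2 ^ k
  order-power-of-two = grow (suc n) trivial 0 trivial-closed (cong suc (sum-replicate-zero n)) (m≤n+m (suc n) ∣ trivial ∣)
    where
    trivial : Part
    trivial x = ⌊ x ≟ zero ⌋
    trivial-closed : Closed trivial
    trivial-closed x y x≡0 y≡0 with toWitness x≡0 | toWitness y≡0
    ... | refl | refl = subst (T ∘ trivial) (sym (∙-identityˡ zero)) _

arc⇔indicator : (F : SDMFFusionRing n) (G : Graph n) (i j : Fin n) →
                (Arc F i j ⇔ T (adj G i j)) ⇔ (N F (suc i) (suc i) (suc j) ≡ indicator (adj G i j))
arc⇔indicator F G i j with adj G i j
... | true  = mk⇔ (λ arc⇔ → Equivalence.from arc⇔ tt) (λ N≡1 → mk⇔ (λ _ → tt) (λ _ → N≡1))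
... | false = mk⇔ (λ arc⇔ → N≡0 (Equivalence.to arc⇔)) (λ N≡0 → mk⇔ (λ N≡1 → ℕ.0≢1+n (trans (sym N≡0) N≡1)) λ ())
  where
  open FusionRingProperties F
  N≡0 : (N F (suc i) (suc i) (suc j) ≡ 1 → ⊥) → N F (suc i) (suc i) (suc j) ≡ 0
  N≡0 ¬arc with N-0∨1 (suc i) (suc i) (suc j)
  ... | inj₁ N≡0 = N≡0
  ... | inj₂ N≡1 = ⊥-elim (¬arc N≡1)

generates-by-indicator : (G : Graph n) (F : SDMFFusionRing n) →
                         (∀ i j → N F (suc i) (suc i) (suc j) ≡ indicator (adj G i j)) → Generates G
generates-by-indicator G F N≡indicator = F , λ i j → Equivalence.from (arc⇔indicator F G i j) (N≡indicator i j)

Table : ℕ → Set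
Table r = Vec (Vec (Vec ℕ r) r) r

entry : ∀ {r} → Table r → Fin r → Fin r → Fin r → ℕ
entry t i j k = lookup (lookup (lookup t i) j) k

-- Every axiom is decided by evaluating all? over the finite index set, so the
-- implicit arguments are solved by computation on concrete tables.
checkedRing : (t : Table (suc n)) →
  {_ : True (all? λ i → all? λ j → all? λ k → entry t i j k ≤? 1)} →
  {_ : True (all? λ j → all? λ k → entry t zero j k ℕ.≟ δ j k)} →
  {_ : True (all? λ i → all? λ j → all? λ k → entry t i j k ℕ.≟ entry t j i k)} →
  {_ : True (all? λ i → all? λ j → all? λ k → all? λ l →
          ΣFin (suc n) (λ m → entry t i j m * entry t m k l) ℕ.≟ ΣFin (suc n) (λ m → entry t j k m * entry t i m l))} →
  {_ : True (all? λ i → all? λ j → entry t i j zero ℕ.≟ δ i j)} →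
  {_ : True (all? λ i → all? λ j → all? λ k → entry t i j k ℕ.≟ entry t j k i)} →
  SDMFFusionRing n
checkedRing t {mult-free} {unit} {comm} {assoc} {dual} {rot} = record
  { N        = entry t
  ; multFree = toWitness mult-free
  ; unit     = toWitness unit
  ; comm     = toWitness comm
  ; assoc    = toWitness assoc
  ; dual₀    = toWitness dual
  ; dualRot  = toWitness rot
  ; dualRev  = toWitness comm
  }

checkedGenerates : (G : Graph n) (F : SDMFFusionRing n) →
  {_ : True (all? λ i → all? λ j → N F (suc i) (suc i) (suc j) ℕ.≟ indicator (adj G i j))} → Generates G
checkedGenerates G F {arcs} = generates-by-indicator G F (toWitness arcs)

-- X² = 1 + X
loopVertex-generates : Generates loopVertex
loopVertex-generates = checkedGenerates loopVertex (checkedRing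
  (((1 ∷ 0 ∷ []) ∷ (0 ∷ 1 ∷ []) ∷ []) ∷
   ((0 ∷ 1 ∷ []) ∷ (1 ∷ 1 ∷ []) ∷ []) ∷ []))

-- X² = 1 + X + Y, XY = X + Y, Y² = 1 + X
edgeOneLoop-generates : Generates edgeOneLoop
edgeOneLoop-generates = checkedGenerates edgeOneLoop (checkedRing
  (((1 ∷ 0 ∷ 0 ∷ []) ∷ (0 ∷ 1 ∷ 0 ∷ []) ∷ (0 ∷ 0 ∷ 1 ∷ []) ∷ []) ∷
   ((0 ∷ 1 ∷ 0 ∷ []) ∷ (1 ∷ 1 ∷ 1 ∷ []) ∷ (0 ∷ 1 ∷ 1 ∷ []) ∷ []) ∷
   ((0 ∷ 0 ∷ 1 ∷ []) ∷ (0 ∷ 1 ∷ 1 ∷ []) ∷ (1 ∷ 1 ∷ 0 ∷ []) ∷ []) ∷ []))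

-- X² = Y² = 1 + X + Y, XY = X + Y + Z, XZ = Y, YZ = X, Z² = 1
edgeTwoLoopsPlusPoint-generates : Generates edgeTwoLoopsPlusPoint
edgeTwoLoopsPlusPoint-generates = checkedGenerates edgeTwoLoopsPlusPoint (checkedRing
  (((1 ∷ 0 ∷ 0 ∷ 0 ∷ []) ∷ (0 ∷ 1 ∷ 0 ∷ 0 ∷ []) ∷ (0 ∷ 0 ∷ 1 ∷ 0 ∷ []) ∷ (0 ∷ 0 ∷ 0 ∷ 1 ∷ []) ∷ []) ∷
   ((0 ∷ 1 ∷ 0 ∷ 0 ∷ []) ∷ (1 ∷ 1 ∷ 1 ∷ 0 ∷ []) ∷ (0 ∷ 1 ∷ 1 ∷ 1 ∷ []) ∷ (0 ∷ 0 ∷ 1 ∷ 0 ∷ []) ∷ []) ∷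
   ((0 ∷ 0 ∷ 1 ∷ 0 ∷ []) ∷ (0 ∷ 1 ∷ 1 ∷ 1 ∷ []) ∷ (1 ∷ 1 ∷ 1 ∷ 0 ∷ []) ∷ (0 ∷ 1 ∷ 0 ∷ 0 ∷ []) ∷ []) ∷
   ((0 ∷ 0 ∷ 0 ∷ 1 ∷ []) ∷ (0 ∷ 0 ∷ 1 ∷ 0 ∷ []) ∷ (0 ∷ 1 ∷ 0 ∷ 0 ∷ []) ∷ (1 ∷ 0 ∷ 0 ∷ 0 ∷ []) ∷ []) ∷ []))

groupRing : BooleanGroup n → SDMFFusionRing n
groupRing {n} G = record
  { N        = λ x y z → δ (x ∙ y) z
  ; multFree = λ x y z → δ≤1 (x ∙ y) z
  ; unit     = λ j k → cong (λ w → δ w k) (∙-identityˡ j)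
  ; comm     = λ i j k → cong (λ w → δ w k) (∙-comm i j)
  ; assoc    = λ i j k l → begin
      ΣFin (suc n) (λ m → δ (i ∙ j) m * δ (m ∙ k) l)   ≡⟨ ΣFin≡sum (suc n) _ ⟩
      sum (λ m → δ (i ∙ j) m * δ (m ∙ k) l)            ≡⟨ sum-δ (i ∙ j) (λ m → δ (m ∙ k) l) ⟩
      δ (i ∙ j ∙ k) l                                  ≡⟨ cong (λ w → δ w l) (∙-assoc i j k) ⟩
      δ (i ∙ (j ∙ k)) l                                ≡⟨ sum-δ (j ∙ k) (λ m → δ (i ∙ m) l) ⟨
      sum (λ m → δ (j ∙ k) m * δ (i ∙ m) l)            ≡⟨ ΣFin≡sum (suc n) _ ⟨
      ΣFin (suc n) (λ m → δ (j ∙ k) m * δ (i ∙ m) l)   ∎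
  ; dual₀    = λ i j → δ-iff (λ i∙j≡0 → trans (sym (rotate i∙j≡0)) (trans (∙-comm j zero) (∙-identityˡ j)))
                              (λ { refl → ∙-self-inverse i })
  ; dualRot  = λ i j k → δ-iff rotate (rotate ∘ rotate)
  ; dualRev  = λ i j k → cong (λ w → δ w k) (∙-comm i j)
  }
  where
  open BooleanGroup G
  open ≡-Reasoning

groupRing-generates : (G : BooleanGroup n) → Generates (emptyGraph n)
groupRing-generates G = generates-by-indicator (emptyGraph _) (groupRing G)
  (λ i j → cong (λ w → δ w (suc j)) (BooleanGroup.∙-self-inverse G (suc i)))

module BooleanGroupVia {A : Set} (β : Fin (suc n) ↔ A) (_⊕_ : A → A → A) (e : A)
  (⊕-assoc : ∀ a b c → (a ⊕ b) ⊕ c ≡ a ⊕ (b ⊕ c)) (⊕-comm : ∀ a b → a ⊕ b ≡ b ⊕ a)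
  (⊕-identityˡ : ∀ a → e ⊕ a ≡ a) (⊕-self-inverse : ∀ a → a ⊕ a ≡ e) where

  -- Translating by the image of zero makes zero the identity element.
  private
    c : A
    c = Inverse.to β zero
    ι : Fin (suc n) → A
    ι x = Inverse.to β x ⊕ c
    ι⁻¹ : A → Fin (suc n)
    ι⁻¹ a = Inverse.from β (a ⊕ c)

    ⊕c⊕c : ∀ a → (a ⊕ c) ⊕ c ≡ a
    ⊕c⊕c a = trans (⊕-assoc a c c) (trans (cong (a ⊕_) (⊕-self-inverse c)) (trans (⊕-comm a e) (⊕-identityˡ a)))
    ι-ι⁻¹ : ∀ a → ι (ι⁻¹ a) ≡ a
    ι-ι⁻¹ a = trans (cong (_⊕ c) (Inverse.strictlyInverseˡ β (a ⊕ c))) (⊕c⊕c a)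
    ι⁻¹-ι : ∀ x → ι⁻¹ (ι x) ≡ x
    ι⁻¹-ι x = trans (cong (Inverse.from β) (⊕c⊕c _)) (Inverse.strictlyInverseʳ β x)

  booleanGroup : BooleanGroup n
  booleanGroup = record
    { _∙_            = λ x y → ι⁻¹ (ι x ⊕ ι y)
    ; ∙-assoc        = λ x y z → cong ι⁻¹ (trans (cong (_⊕ ι z) (ι-ι⁻¹ _))
                         (trans (⊕-assoc (ι x) (ι y) (ι z)) (cong (ι x ⊕_) (sym (ι-ι⁻¹ _)))))
    ; ∙-comm         = λ x y → cong ι⁻¹ (⊕-comm (ι x) (ι y))
    ; ∙-identityˡ    = λ x → trans (cong ι⁻¹ (trans (cong (_⊕ ι x) (⊕-self-inverse c)) (⊕-identityˡ (ι x)))) (ι⁻¹-ι x)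
    ; ∙-self-inverse = λ x → trans (cong ι⁻¹ (⊕-self-inverse (ι x)))
                         (trans (cong (Inverse.from β) (⊕-identityˡ c)) (Inverse.strictlyInverseʳ β zero))
    }

Fin2^k↔bits : ∀ k → Fin (2 ^ k) ↔ Vec Bool k
Fin2^k↔bits zero    = mk↔ₛ′ (λ _ → []) (λ _ → zero) (λ { [] → refl }) (λ { zero → refl })
Fin2^k↔bits (suc k) = ↔-trans *↔× (↔-trans (2↔Bool ×-↔ Fin2^k↔bits k) cons↔)
  where
  cons↔ : (Bool × Vec Bool k) ↔ Vec Bool (suc k)
  cons↔ = mk↔ₛ′ (uncurry _∷_) (λ { (b ∷ u) → b , u }) (λ { (b ∷ u) → refl }) (λ { (b , u) → refl })

xor-self : ∀ {k} (u : Vec Bool k) → zipWith _xor_ u u ≡ replicate k false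
xor-self []      = refl
xor-self (b ∷ u) = cong₂ _∷_ (xor-same b) (xor-self u)

elementaryAbelian : ∀ k → BooleanGroup (2 ^ k ∸ 1)
elementaryAbelian k = BooleanGroupVia.booleanGroup β (zipWith _xor_) (replicate k false)
  (zipWith-assoc xor-assoc) (zipWith-comm xor-comm) (zipWith-identityˡ (λ _ → refl)) xor-self
  where
  β : Fin (suc (2 ^ k ∸ 1)) ↔ Vec Bool k
  β = subst (λ r → Fin r ↔ Vec Bool k)
        (sym (trans (ℕ.+-comm 1 (2 ^ k ∸ 1)) (ℕ.m∸n+n≡m (ℕ.m^n>0 2 k)))) (Fin2^k↔bits k)

pullback : Fin n ↔ Fin m → SDMFFusionRing m → SDMFFusionRing n
pullback {n} {m} π F = record
  { N        = λ x y z → N F (up x) (up y) (up z)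
  ; multFree = λ x y z → multFree F (up x) (up y) (up z)
  ; unit     = λ j k → trans (unit F (up j) (up k)) δ-up
  ; comm     = λ i j k → comm F (up i) (up j) (up k)
  ; assoc    = λ i j k l → begin
      ΣFin (suc n) (λ x → N F (up i) (up j) (up x) * N F (up x) (up k) (up l))  ≡⟨ ΣFin≡sum (suc n) _ ⟩
      sum (λ x → N F (up i) (up j) (up x) * N F (up x) (up k) (up l))           ≡⟨ ∑-permute (λ y → N F (up i) (up j) y * N F y (up k) (up l)) π₀ ⟨
      sum (λ y → N F (up i) (up j) y * N F y (up k) (up l))                     ≡⟨ ΣFin≡sum (suc m) _ ⟨
      ΣFin (suc m) (λ y → N F (up i) (up j) y * N F y (up k) (up l))            ≡⟨ assoc F (up i) (up j) (up k) (up l) ⟩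
      ΣFin (suc m) (λ y → N F (up j) (up k) y * N F (up i) y (up l))            ≡⟨ ΣFin≡sum (suc m) _ ⟩
      sum (λ y → N F (up j) (up k) y * N F (up i) y (up l))                     ≡⟨ ∑-permute (λ y → N F (up j) (up k) y * N F (up i) y (up l)) π₀ ⟩
      sum (λ x → N F (up j) (up k) (up x) * N F (up i) (up x) (up l))           ≡⟨ ΣFin≡sum (suc n) _ ⟨
      ΣFin (suc n) (λ x → N F (up j) (up k) (up x) * N F (up i) (up x) (up l))  ∎
  ; dual₀    = λ i j → trans (dual₀ F (up i) (up j)) δ-up
  ; dualRot  = λ i j k → dualRot F (up i) (up j) (up k)
  ; dualRev  = λ i j k → dualRev F (up i) (up j) (up k)
  }
  where
  open ≡-Reasoning
  π₀ : Permutation (suc n) (suc m)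
  π₀ = lift₀ π
  up : Fin (suc n) → Fin (suc m)
  up = π₀ ⟨$⟩ʳ_
  δ-up : ∀ {x y} → δ (up x) (up y) ≡ δ x y
  δ-up = δ-iff (λ up-x≡up-y → trans (sym (inverseˡ π₀)) (trans (cong (π₀ ⟨$⟩ˡ_) up-x≡up-y) (inverseˡ π₀))) (cong up)

generates-≅ : (G : Graph n) (H : Graph m) → G ≅ H → Generates H → Generates G
generates-≅ G H (π , adj≡) (F , arcs) = pullback π F , λ i j →
  mk⇔ (λ arc → subst T (sym (adj≡ i j)) (Equivalence.to (arcs _ _) arc))
      (λ edge → Equivalence.from (arcs _ _) (subst T (adj≡ i j) edge))

≅-enumeration : (G : Graph n) (H : Graph m) (ψ : Fin m → Fin n) → (∀ {i j} → ψ i ≡ ψ j → i ≡ j) →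
                (∀ x → ∃ λ i → ψ i ≡ x) → (∀ i j → adj G (ψ i) (ψ j) ≡ adj H i j) → G ≅ H
≅-enumeration {n} {m} G H ψ ψ-injective ψ-onto adj≡ =
  mk↔ₛ′ φ ψ (λ i → ψ-injective (ψ-φ (ψ i))) ψ-φ ,
  λ x y → trans (cong₂ (adj G) (sym (ψ-φ x)) (sym (ψ-φ y))) (adj≡ (φ x) (φ y))
  where
  φ : Fin n → Fin m
  φ x = proj₁ (ψ-onto x)
  ψ-φ : ∀ x → ψ (φ x) ≡ x
  ψ-φ x = proj₂ (ψ-onto x)

≅-empty : (G : Graph n) → n ≡ m → (∀ i j → adj G i j ≡ false) → G ≅ emptyGraph m
≅-empty G refl no-edges = ↔-refl , no-edges

Classification : Graph n → Set
Classification G = G ≅ loopVertex ⊎ G ≅ edgeOneLoop ⊎ G ≅ edgeTwoLoopsPlusPoint ⊎ ∃[ k ] (G ≅ emptyGraph (2 ^ k ∸ 1))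

classification-generates : (G : Graph n) → Classification G → Generates G
classification-generates G (inj₁ G≅)                     = generates-≅ G loopVertex G≅ loopVertex-generates
classification-generates G (inj₂ (inj₁ G≅))              = generates-≅ G edgeOneLoop G≅ edgeOneLoop-generates
classification-generates G (inj₂ (inj₂ (inj₁ G≅)))       = generates-≅ G edgeTwoLoopsPlusPoint G≅ edgeTwoLoopsPlusPoint-generates
classification-generates G (inj₂ (inj₂ (inj₂ (k , G≅)))) = generates-≅ G (emptyGraph (2 ^ k ∸ 1)) G≅ (groupRing-generates (elementaryAbelian k))

module Classify (G : Graph n) (triangle-free : TriangleFree G) (F : SDMFFusionRing n)
                (arcs : ∀ i j → Arc F i j ⇔ T (adj G i j)) where
  open FusionRingProperties F

  N≡adj : ∀ i j → N F (suc i) (suc i) (suc j) ≡ indicator (adj G i j)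
  N≡adj i j = Equivalence.to (arc⇔indicator F G i j) (arcs i j)

  adj-true : ∀ {i j} → N F (suc i) (suc i) (suc j) ≡ 1 → adj G i j ≡ true
  adj-true {i} {j} N≡1 = indicator≡1 (trans (sym (N≡adj i j)) N≡1)

  adj-false : ∀ {i j} → N F (suc i) (suc i) (suc j) ≡ 0 → adj G i j ≡ false
  adj-false {i} {j} N≡0 = indicator≡0 (trans (sym (N≡adj i j)) N≡0)

  N-sym : ∀ {x y} → ¬ x ≡ zero → ¬ y ≡ zero → N F x x y ≡ N F y y x
  N-sym {zero}  x≢0 _   = ⊥-elim (x≢0 refl)
  N-sym {suc i} {zero} _ y≢0 = ⊥-elim (y≢0 refl)
  N-sym {suc i} {suc j} _ _ = trans (N≡adj i j) (trans (cong indicator (adjSym G i j)) (sym (N≡adj j i)))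

  no-triangle : ∀ {x y z} → ¬ x ≡ zero → ¬ y ≡ zero → ¬ z ≡ zero → ¬ x ≡ y → ¬ y ≡ z → ¬ x ≡ z →
                N F x x y ≡ 1 → N F y y z ≡ 1 → N F x x z ≡ 1 → ⊥
  no-triangle {zero} x≢0 _ _ _ _ _ _ _ _ = x≢0 refl
  no-triangle {suc _} {zero} _ y≢0 _ _ _ _ _ _ _ = y≢0 refl
  no-triangle {suc _} {suc _} {zero} _ _ z≢0 _ _ _ _ _ _ = z≢0 refl
  no-triangle {suc i} {suc j} {suc k} _ _ _ x≢y y≢z x≢z xy yz xz =
    triangle-free i j k (x≢y ∘ cong suc) (y≢z ∘ cong suc) (x≢z ∘ cong suc)
      (Equivalence.to (arcs i j) xy) (Equivalence.to (arcs j k) yz) (Equivalence.to (arcs i k) xz)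

  open SymmetricTriangleFree F N-sym no-triangle

  suc≢0 : ∀ {i : Fin n} → ¬ suc i ≡ zero
  suc≢0 ()

  suc-≢ : ∀ {i j : Fin n} → ¬ i ≡ j → ¬ suc i ≡ suc j
  suc-≢ i≢j = i≢j ∘ suc-injective

  squares-trivial : (∀ i → ¬ suc i ∼ suc i) → ∀ x m → ¬ m ≡ zero → N F x x m ≡ 0
  squares-trivial _        zero    m       m≢0 = trans (unit F zero m) (δ-≢ (m≢0 ∘ sym))
  squares-trivial _        (suc i) zero    m≢0 = ⊥-elim (m≢0 refl)
  squares-trivial loopless (suc i) (suc j) _ with i ≟ j | N-0∨1 (suc i) (suc i) (suc j)
  ... | yes refl | _        = N-≢1 (loopless i)
  ... | no _     | inj₁ i≁j = i≁j
  ... | no i≢j   | inj₂ i∼j = ⊥-elim (no-loopless-edge suc≢0 suc≢0 (suc-≢ i≢j) i∼j (N-≢1 (loopless i)) (N-≢1 (loopless j)))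

  loopless-empty : (∀ i → ¬ suc i ∼ suc i) → ∃[ k ] (G ≅ emptyGraph (2 ^ k ∸ 1))
  loopless-empty loopless with BooleanGroupOrder.order-power-of-two (BasisGroup.booleanGroup F (squares-trivial loopless))
  ... | k , |basis|≡2^k = k , ≅-empty G (cong (_∸ 1) |basis|≡2^k) (λ i j → adj-false (squares-trivial loopless (suc i) (suc j) suc≢0))

  module _ (a : Fin n) (a∼a : suc a ∼ suc a) where

    lone-loop : (∀ j → ¬ j ≡ a → N F (suc a) (suc a) (suc j) ≡ 0) → G ≅ loopVertex
    lone-loop no-neighbour = ≅-enumeration G loopVertex (λ _ → a) (λ { {zero} {zero} _ → refl })
      (λ x → zero , sym (only-a x)) (λ { zero zero → adj-true a∼a })
      where
      neighbours : ∀ {m} → ¬ m ≡ zero → ¬ m ≡ suc a → ¬ m ≡ suc a → N F (suc a) (suc a) m ≡ 0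
      neighbours {zero}  m≢0 _   _ = ⊥-elim (m≢0 refl)
      neighbours {suc j} _   j≢a _ = no-neighbour j (j≢a ∘ cong suc)
      only-a : ∀ x → x ≡ a
      only-a x with x ≟ a
      ... | yes x≡a = x≡a
      ... | no x≢a  = ⊥-elim (no-vertex-outside suc≢0 suc≢0 suc≢0 (suc-≢ x≢a) (suc-≢ x≢a) a∼a neighbours neighbours
                        (trans (N-swap₂₃ (suc a) (suc x) (suc a)) (neighbours suc≢0 (suc-≢ x≢a) (suc-≢ x≢a))))

    looped-loopless-edge : (b : Fin n) → ¬ b ≡ a → suc a ∼ suc b → N F (suc b) (suc b) (suc b) ≡ 0 → G ≅ edgeOneLoop
    looped-loopless-edge b b≢a a∼b b-loopless = ≅-enumeration G edgeOneLoop ψ ψ-injective onto adj≡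
      where
      module E = LoopedLooplessEdge suc≢0 suc≢0 (suc-≢ (b≢a ∘ sym)) a∼a b-loopless a∼b
      ψ : Fin 2 → Fin n
      ψ zero       = a
      ψ (suc zero) = b
      ψ-injective : ∀ {i j} → ψ i ≡ ψ j → i ≡ j
      ψ-injective {zero}     {zero}     _   = refl
      ψ-injective {zero}     {suc zero} a≡b = ⊥-elim (b≢a (sym a≡b))
      ψ-injective {suc zero} {zero}     b≡a = ⊥-elim (b≢a b≡a)
      ψ-injective {suc zero} {suc zero} _   = refl
      onto : ∀ x → ∃ λ i → ψ i ≡ x
      onto x with x ≟ a | x ≟ b
      ... | yes x≡a | _       = zero , sym x≡a
      ... | no _    | yes x≡b = suc zero , sym x≡b
      ... | no x≢a  | no x≢b  = ⊥-elim (no-vertex-outside suc≢0 suc≢0 suc≢0 (suc-≢ x≢a) (suc-≢ x≢b) a∼a E.a-neighbours E.b-neighbours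
                                  (trans (N-swap₂₃ (suc a) (suc x) (suc b)) (E.ab-constituents (suc x) (suc-≢ x≢a ∷ suc-≢ x≢b ∷ []))))
      adj≡ : ∀ i j → adj G (ψ i) (ψ j) ≡ edgeOneLoopAdj i j
      adj≡ zero       zero       = adj-true a∼a
      adj≡ zero       (suc zero) = adj-true a∼b
      adj≡ (suc zero) zero       = adj-true E.b∼a
      adj≡ (suc zero) (suc zero) = adj-false b-loopless

    module _ (b : Fin n) (b≢a : ¬ b ≡ a) (a∼b : suc a ∼ suc b) (b∼b : suc b ∼ suc b)
             (k : Fin n) (k≢a : ¬ suc k ≡ suc a) (k≢b : ¬ suc k ≡ suc b) (k∈a⊗b : N F (suc a) (suc b) (suc k) ≡ 1) where

      E : LoopedEdge
      E = record { a = suc a ; b = suc b ; k = suc k ; a≢0 = suc≢0 ; b≢0 = suc≢0 ; k≢0 = suc≢0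
                 ; a≢b = suc-≢ (b≢a ∘ sym) ; k≢a = k≢a ; k≢b = k≢b ; a∼a = a∼a ; b∼b = b∼b ; a∼b = a∼b ; k∈a⊗b = k∈a⊗b }
      module E = LoopedEdge E

      isolated-third-shape : E.ThirdIsolated → G ≅ edgeTwoLoopsPlusPoint
      isolated-third-shape isolated = ≅-enumeration G edgeTwoLoopsPlusPoint ψ ψ-injective onto adj≡
        where
        ψ : Fin 3 → Fin n
        ψ zero             = a
        ψ (suc zero)       = b
        ψ (suc (suc zero)) = k
        ψ-injective : ∀ {i j} → ψ i ≡ ψ j → i ≡ j
        ψ-injective {zero}           {zero}           _ = refl
        ψ-injective {zero}           {suc zero}       e = ⊥-elim (b≢a (sym e))
        ψ-injective {zero}           {suc (suc zero)} e = ⊥-elim (k≢a (cong suc (sym e)))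
        ψ-injective {suc zero}       {zero}           e = ⊥-elim (b≢a e)
        ψ-injective {suc zero}       {suc zero}       _ = refl
        ψ-injective {suc zero}       {suc (suc zero)} e = ⊥-elim (k≢b (cong suc (sym e)))
        ψ-injective {suc (suc zero)} {zero}           e = ⊥-elim (k≢a (cong suc e))
        ψ-injective {suc (suc zero)} {suc zero}       e = ⊥-elim (k≢b (cong suc e))
        ψ-injective {suc (suc zero)} {suc (suc zero)} _ = refl
        onto : ∀ x → ∃ λ i → ψ i ≡ x
        onto x with x ≟ a | x ≟ b | x ≟ k
        ... | yes x≡a | _       | _       = zero , sym x≡a
        ... | no _    | yes x≡b | _       = suc zero , sym x≡b
        ... | no _    | no _    | yes x≡k = suc (suc zero) , sym x≡k
        ... | no x≢a  | no x≢b  | no x≢k  = ⊥-elim (no-fourth-vertex E isolated suc≢0 (suc-≢ x≢a) (suc-≢ x≢b) (suc-≢ x≢k))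
        k-isolated : ∀ x → adj G k x ≡ false
        k-isolated x = adj-false (third-isolated E isolated suc≢0)
        adj≡ : ∀ i j → adj G (ψ i) (ψ j) ≡ edgeTwoLoopsAdj i j
        adj≡ zero             zero             = adj-true a∼a
        adj≡ zero             (suc zero)       = adj-true a∼b
        adj≡ zero             (suc (suc zero)) = trans (adjSym G a k) (k-isolated a)
        adj≡ (suc zero)       zero             = adj-true E.b∼a
        adj≡ (suc zero)       (suc zero)       = adj-true b∼b
        adj≡ (suc zero)       (suc (suc zero)) = trans (adjSym G b k) (k-isolated b)
        adj≡ (suc (suc zero)) j                = k-isolated (ψ j)

      third-shape : G ≅ edgeTwoLoopsPlusPoint
      third-shape with N-0∨1 (suc k) (suc k) (suc a) | N-0∨1 (suc k) (suc k) (suc b)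
      ... | inj₁ k≁a | inj₁ k≁b = isolated-third-shape (k≁a , k≁b)
      ... | inj₂ k∼a | inj₁ k≁b = ⊥-elim (third-not-adjacent-to-a-alone E k∼a k≁b)
      ... | inj₁ k≁a | inj₂ k∼b = ⊥-elim (third-not-adjacent-to-a-alone (swap E) k∼b k≁a)
      ... | inj₂ k∼a | inj₂ k∼b = ⊥-elim (no-triangle suc≢0 suc≢0 suc≢0 E.a≢b (≢-sym k≢b) (≢-sym k≢a) a∼b
                                     (∼-sym suc≢0 suc≢0 k∼b) (∼-sym suc≢0 suc≢0 k∼a))

    looped-edge : (b : Fin n) → ¬ b ≡ a → suc a ∼ suc b → suc b ∼ suc b → G ≅ edgeTwoLoopsPlusPoint
    looped-edge b b≢a a∼b b∼b with sum-nonzero-outside (N F (suc a) (suc b)) ((a≢b ∷ []) ∷ [] ∷ []) two<summands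
      where
      a≢b : ¬ suc a ≡ suc b
      a≢b = suc-≢ (b≢a ∘ sym)
      -- X_a X_b has exactly three constituents, two of which are a and b.
      two<summands : sumOver (suc a ∷ suc b ∷ []) (N F (suc a) (suc b)) < summands (suc a) (suc b)
      two<summands = subst₂ _<_ (sym (sumOver-values (N F (suc a) (suc b)) (N-xyx a∼b ∷ N-xyy (∼-sym suc≢0 suc≢0 a∼b) ∷ [])))
                                (sym (summands-looped-edge suc≢0 suc≢0 a≢b a∼a b∼b a∼b)) ≤-refl
    ... | zero  , _                    , N≢0 = ⊥-elim (N≢0 (N-unit-≢ (suc-≢ (b≢a ∘ sym))))
    ... | suc k , (k≢a ∷ k≢b ∷ []) , N≢0 = third-shape b b≢a a∼b b∼b k k≢a k≢b (N-≢0 N≢0)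

  classify : Classification G
  classify with any? (λ i → N F (suc i) (suc i) (suc i) ℕ.≟ 1)
  ... | no no-loop = inj₂ (inj₂ (inj₂ (loopless-empty (λ i i∼i → no-loop (i , i∼i)))))
  ... | yes (a , a∼a) with any? (λ j → ¬? (j ≟ a) ×-dec (N F (suc a) (suc a) (suc j) ℕ.≟ 1))
  ...   | no no-neighbour = inj₁ (lone-loop a a∼a (λ j j≢a → N-≢1 (λ a∼j → no-neighbour (j , j≢a , a∼j))))
  ...   | yes (b , b≢a , a∼b) with N-0∨1 (suc b) (suc b) (suc b)
  ...     | inj₁ b-loopless = inj₂ (inj₁ (looped-loopless-edge a a∼a b b≢a a∼b b-loopless))
  ...     | inj₂ b∼b        = inj₂ (inj₂ (inj₁ (looped-edge a a∼a b b≢a a∼b b∼b)))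

mainTheorem13 : ∀ (n : ℕ) (G : Graph n) → TriangleFree G →
  (Generates G ⇔
    (G ≅ loopVertex ⊎ G ≅ edgeOneLoop ⊎ G ≅ edgeTwoLoopsPlusPoint ⊎
      ∃[ k ] (G ≅ emptyGraph (2 ^ k ∸ 1))))
mainTheorem13 n G triangle-free =
  mk⇔ (λ (F , arcs) → Classify.classify G triangle-free F arcs) (classification-generates G)
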